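{- For every composition $F$ of $I$, $\mathcal D(\hat{\mathtt{M}}_F)=\check{\mathtt{M}}_F$; that is, under the polyhedral duality $\mathcal D$, the characteristic function of the relatively open face $\hat{\mathtt{M}}_F$ of the braid arrangement is sent to $(-1)^{l(F)-1}$ times the characteristic functional of the relative interior of the permutohedral tangent cone $\sigma^\vee_{\bar F}$.
   Context: Let $\mathbb{k}$ be a field of characteristic zero and $I$ a finite set. Braid side: $\mathrm{T}^I=\mathbb{R}^I/\mathbb{R}\lambda_I$, coroots $h_{i_1i_2}$ with $\langle h_{i_1i_2},\lambda\rangle=\lambda(i_1)-\lambda(i_2)$, halfspaces $\hat{\mathtt{C}}_{i_1i_2}$ (indicator of $\langle h_{i_1i_2},\lambda\rangle\ge0$). For a preposet $p$ (identified with its set of pairs $(i_1,i_2)$, $i_1\ne i_2$, $i_1\ge_p i_2$) the braid cone is $\hat{\mathtt{C}}_p=\prod_{(i_1,i_2)\in p}\hat{\mathtt{C}}_{i_1i_2}$; it is the characteristic function of the cone $\sigma_p$ generated by the fundamental weights $\lambda_{ST}$ (image of the indicator of $S$) with $S$ upward and $T$ downward closed in $p$. Compositions $F$ are identified with total preposets ($i_1\ge i_2$ iff the lump of $i_1$ is weakly left of that of $i_2$); $l(F)$ is the number of lumps and $\bar F$ the composition with lumps in reverse order. The face $\hat{\mathtt{M}}_F:\mathrm{T}^I\to\mathbb{k}$ is the indicator of the set of $\lambda$ whose induced total preorder on $I$ (via $\lambda(i_1)\ge\lambda(i_2)$) equals $F$. $\hat{\mathbf{\Sigma}}^*[I]$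 is the algebra of functions on $\mathrm{T}^I$ generated by the halfspaces. Adjoint side: $\mathrm{T}^\vee_I=\{h\in\mathbb{R}I:\sum_ih_i=0\}$; for each two-lump composition $(S,T)$ the halfspace $\check{\mathtt{Y}}_{ST}$ is the indicator of $\langle h,\lambda_{ST}\rangle\ge0$. The adjoint faces $\check{\mathtt{H}}_{\mathcal S}$ are the indicators of the relatively open faces of the arrangement of special hyperplanes $\langle h,\lambda_{ST}\rangle=0$; the span $\check{\mathbf{\Sigma}}^\vee[I]$ of the algebra generated by the $\check{\mathtt{Y}}_{ST}$ is given the inner product making the adjoint faces orthonormal, and the characteristic functional of a region is the Riesz representative of its characteristic function. $\sigma^\vee_p=\{h:\langle h,\lambda\rangle\ge0\ \forall\lambda\in\sigma_p\}$ is the cone generated by the coroots $h_{i_1i_2}$, $(i_1,i_2)\in p$ (a generalized permutohedral tangent cone; for compositions, a permutohedral tangent cone). $\check{\mathtt{C}}_p$ is the characteristic functional of $\sigma^\vee_p$, $\check{\mathbf{\Sigma}}^*[I]$ is the span of the $\check{\mathtt{C}}_p$, and $\mathcal D:\hat{\mathbf{\Sigma}}^*\to\check{\mathbf{\Sigma}}^*$, $\hat{\mathtt{C}}_p\mapsto\check{\mathtt{C}}_p$, is the linear isomorphism given by duality of polyhedral algebras; it sends pointwise products to convolution $\check{\mathtt{C}}_p\star\check{\mathtt{C}}_q=\check{\mathtt{C}}_{p\cup q}$ ($p\cup q$ the transitive closure of the union). Finally $\check{\mathtt{M}}_F$ denotes $(-1)^{l(F)-1}$ times the characteristic functional of the relative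 interior of $\sigma^\vee_{\bar F}$.
   Formalization: Points of $\mathrm{T}^I$ and $\mathrm{T}^\vee_I$ have rational rather than real coordinates, and the relative interior of $\sigma^\vee_{\bar F}$ is tested with rational points and rational scalars. -}

module Defs where

open import Level using (Level; _⊔_)
open import Data.Bool using (Bool; true; false; if_then_else_; _∧_; _∨_; not)
open import Data.Nat as ℕ using (ℕ; zero; suc)
open import Data.Fin as Fin using (Fin; toℕ; opposite)
open import Data.Fin.Properties using (opposite-involutive)
open import Data.List using (List; []; _∷_; foldr; map; allFin; cartesianProduct; concatMap)
open import Data.Bool.ListAction using (all; any)
open import Data.Product using (Σ; Σ-syntax; ∃; ∃-syntax; _×_; _,_)
open import Data.Rational as ℚ using (ℚ; 0ℚ; _≤_; _<_; _≤ᵇ_)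
import Data.Rational.Properties as ℚP
open import Relation.Nullary using (¬_)
open import Relation.Nullary.Decidable using (⌊_⌋)
open import Relation.Binary.PropositionalEquality using (_≡_; cong; trans)
open import Algebra.Bundles using (CommutativeRing)
open import Function using (_∘_; _⇔_)

-- The finite set I is Fin n.

-- A (raw) relation on I, read "rel i j ≡ true" as  i ≥_p j.
BRel : ℕ → Set
BRel n = Fin n → Fin n → Bool

record Preposet (n : ℕ) : Set where
  field
    rel    : BRel n
    reflex : ∀ i → rel i i ≡ true
    trans' : ∀ i j k → rel i j ≡ true → rel j k ≡ true → rel i k ≡ true
open Preposet public

-- Compositions of I: a surjection onto the lumps 0,…,l-1 (lump 0 leftmost).
record Composition (n : ℕ) : Set where
  field
    l    : ℕ
    lump : Fin n → Fin l
    surj : ∀ k → ∃[ i ] lump i ≡ k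
open Composition public

compRel : ∀ {n} → Composition n → BRel n
compRel F i j = toℕ (lump F i) ℕ.≤ᵇ toℕ (lump F j)

bar : ∀ {n} → Composition n → Composition n
bar F = record
  { l = l F
  ; lump = opposite ∘ lump F
  ; surj = λ k → helper k (surj F (opposite k)) }
  where
  helper : ∀ k → ∃[ i ] lump F i ≡ opposite k → ∃[ i ] opposite (lump F i) ≡ k
  helper k (i , eq) = i , trans (cong opposite eq) (opposite-involutive k)

-- Points.  Points of T^I are represented by λ : Fin n → ℚ (functions on T^I
-- below are invariant under adding constants); points of T^∨_I are
-- h : Fin n → ℚ with Σ h = 0.  (Rational points.)

sumℚ : List ℚ → ℚ
sumℚ = foldr ℚ._+_ 0ℚ

totalSum : ∀ {n} → (Fin n → ℚ) → ℚ
totalSum {n} h = sumℚ (map h (allFin n))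

Subset : ℕ → Set
Subset n = Fin n → Bool

consS : ∀ {n} → Bool → Subset n → Subset (suc n)
consS b S Fin.zero    = b
consS b S (Fin.suc i) = S i

allSubsets : (n : ℕ) → List (Subset n)
allSubsets zero    = (λ ()) ∷ []
allSubsets (suc n) = concatMap (λ S → consS false S ∷ consS true S ∷ []) (allSubsets n)

pairs : ∀ n → List (Fin n × Fin n)
pairs n = cartesianProduct (allFin n) (allFin n)

-- ⟨h , λ_S T⟩ = Σ_{i ∈ S} h_i
pairingST : ∀ {n} → Subset n → (Fin n → ℚ) → ℚ
pairingST {n} S h = sumℚ (map (λ i → if S i then h i else 0ℚ) (allFin n))

upClosed : ∀ {n} → BRel n → Subset n → Bool
upClosed {n} r S = all (λ { (i , j) → not (r j i ∧ S i) ∨ S j }) (pairs n)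

-- (S , T) is a two-lump composition: S and T = I∖S both nonempty
twoLump : ∀ {n} → Subset n → Bool
twoLump {n} S = any S (allFin n) ∧ any (not ∘ S) (allFin n)

-- membership in σ^∨_p = { h ∈ T^∨ : ⟨h,λ⟩ ≥ 0 for all λ ∈ σ_p }, σ_p being
-- generated by the λ_ST with (S,T) two-lump, S upward and T downward closed in p.
inDualCone : ∀ {n} → BRel n → (Fin n → ℚ) → Bool
inDualCone {n} r h =
  ⌊ totalSum h ℚP.≟ 0ℚ ⌋ ∧
  all (λ S → not (upClosed r S ∧ twoLump S) ∨ (0ℚ ≤ᵇ pairingST S h)) (allSubsets n)

-- relative interior of σ^∨_p (standard characterisation of the relative
-- interior of a convex set: every segment in the set can be prolonged past h)
RelIntDualCone : ∀ {n} → BRel n → (Fin n → ℚ) → Set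
RelIntDualCone r h =
  inDualCone r h ≡ true ×
  (∀ y → inDualCone r y ≡ true →
     ∃[ ε ] (0ℚ < ε × inDualCone r (λ i → h i ℚ.+ ε ℚ.* (h i ℚ.- y i)) ≡ true))

InducedIs : ∀ {n} → (Fin n → ℚ) → Composition n → Set
InducedIs {n} λ' F = ∀ (i j : Fin n) → (λ' j ≤ λ' i) ⇔ (compRel F i j ≡ true)

module _ {c ℓ : Level} (R : CommutativeRing c ℓ) where
  open CommutativeRing R

  IsFieldCR : Set (c ⊔ ℓ)
  IsFieldCR = (¬ (1# ≈ 0#)) × (∀ x → ¬ (x ≈ 0#) → ∃[ y ] (x * y ≈ 1#))

  natK : ℕ → Carrier
  natK zero    = 0#
  natK (suc m) = 1# + natK m

  CharZero : Set ℓ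
  CharZero = ∀ m → natK m ≈ 0# → m ≡ 0

module Over {c ℓ : Level} (R : CommutativeRing c ℓ) where
  open CommutativeRing R

  ind : Bool → Carrier
  ind b = if b then 1# else 0#

  sign : ℕ → Carrier
  sign zero    = 1#
  sign (suc m) = - sign m

  halfspace : ∀ {n} → Fin n → Fin n → (Fin n → ℚ) → Carrier
  halfspace i j λ' = ind (λ' j ≤ᵇ λ' i)

  braidCone : ∀ {n} → BRel n → (Fin n → ℚ) → Carrier
  braidCone {n} r λ' =
    foldr (λ { (i , j) acc → if not ⌊ i Fin.≟ j ⌋ ∧ r i j then halfspace i j λ' * acc else acc })
          1# (pairs n)

  -- characteristic function of σ^∨_p on T^∨ (adjoint faces being orthonormal,
  -- the characteristic functional Č_p is identified with it)
  checkCone : ∀ {n} → BRel n → (Fin n → ℚ) → Carrier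
  checkCone r h = ind (inDualCone r h)

  -- finite linear combinations Σ c_p Ĉ_p  and their images  Σ c_p Č_p under 𝒟
  Combo : ℕ → Set c
  Combo n = List (Carrier × Preposet n)

  evalHat : ∀ {n} → Combo n → (Fin n → ℚ) → Carrier
  evalHat cs λ' = foldr (λ { (a , p) acc → a * braidCone (rel p) λ' + acc }) 0# cs

  evalCheck : ∀ {n} → Combo n → (Fin n → ℚ) → Carrier
  evalCheck cs h = foldr (λ { (a , p) acc → a * checkCone (rel p) h + acc }) 0# cs

  RepresentsHatM : ∀ {n} → Composition n → Combo n → Set ℓ
  RepresentsHatM F cs = ∀ λ' →
    (InducedIs λ' F → evalHat cs λ' ≈ 1#) × (¬ InducedIs λ' F → evalHat cs λ' ≈ 0#)

  RepresentsCheckM : ∀ {n} → Composition n → Combo n → Set ℓ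
  RepresentsCheckM F cs = ∀ h → totalSum h ≡ 0ℚ →
    (RelIntDualCone (compRel (bar F)) h → evalCheck cs h ≈ sign (l F ℕ.∸ 1)) ×
    (¬ RelIntDualCone (compRel (bar F)) h → evalCheck cs h ≈ 0#)

{-# OPTIONS --safe #-}
-- Fix h with Σᵢ hᵢ = 0.  For g on the integer points of T^I, chainSum g is the alternating sum of
-- g (1_{S₁} + ⋯ + 1_{Sₘ}) over the chains I ⊋ S₁ ⊋ ⋯ ⊋ Sₘ of sets with ⟨h, λ_S⟩ < 0.  It is linear in g, and
-- at a braid cone Ĉ_p only chains of p-upsets survive, leaving a signed count of chains of h-negative p-upsets.
-- If such upsets exist, one minimising ⟨h, ·⟩ meets each of them in an h-negative upset (submodularity of
-- S ↦ ⟨h, λ_S⟩); this conical contraction of their poset makes the count 0.  Otherwise h ∈ σ^∨_p and the count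
-- is 1.  So chainSum computes (𝒟 f)(h) for every combination f of braid cones, and depends on f only as a
-- function.  For f = M̂_F the only chain whose point induces F is that of the unions of initial lumps of F; it
-- contributes (-1)^{l(F)-1} exactly when all of them are h-negative, which is the condition for h to lie in the
-- relative interior of σ^∨_{F̄}.  Finally M̂_F = ∏_{(a,b)} (Ĉ_ab or 1 - Ĉ_ab) expands into braid cones.
module Submission where

open import Defs
open import Level using (Level)
open import Function using (_∘_; _⇔_; Equivalence; mk⇔)
open import Data.Empty using (⊥-elim)
open import Data.Product using (∃-syntax; Σ-syntax; _×_; _,_; proj₁; proj₂)
open import Data.Sum using (inj₁; inj₂)
open import Relation.Nullary using (¬_; yes; no)
open import Relation.Nullary.Decidable using (⌊_⌋; toWitness; fromWitness)
open import Relation.Binary.PropositionalEquality using (_≡_; _≢_; refl; sym; trans; cong; cong₂; subst; subst₂; module ≡-Reasoning)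
open import Relation.Binary.Bundles using (DecTotalOrder)
open import Relation.Binary.Definitions using (tri<; tri≈; tri>)
open import Data.Bool as Bool using (Bool; true; false; if_then_else_; _∧_; _∨_; not)
open import Data.Bool.Properties
  using (∧-assoc; ∧-comm; ∧-conicalˡ; ∧-conicalʳ; ∨-zeroʳ; ∧-zeroʳ; ∧-identityʳ; ¬-not; not-injective; ⇔→≡; T-≡)
open import Data.Bool.ListAction using (all; any)
open import Data.Nat as ℕ using (ℕ; zero; suc; _≤_; _<_; z≤n; s≤s)
import Data.Nat.Properties as ℕP
open import Data.Nat.Coprimality as Coprime using (1-coprimeTo)
open import Data.Integer using (+_)
import Data.Integer.Properties as ℤP
open import Data.Rational as ℚ using (ℚ; mkℚ; 0ℚ; 1ℚ)
import Data.Rational.Properties as ℚP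
open import Data.Rational.Solver using (module +-*-Solver)
open import Data.Fin as Fin using (Fin; toℕ)
import Data.Fin.Properties as FinP
open import Data.List using (List; []; _∷_; _++_; foldr; map; allFin; concatMap; tabulate; filter)
import Data.List.Properties as ListP
open import Data.List.Membership.Propositional using (_∈_; lose; find)
open import Data.List.Membership.Propositional.Properties using (∈-allFin; ∈-cartesianProduct⁺; ∈-concatMap⁺; ∈-filter⁺; ∈-map⁺)
open import Data.List.Relation.Unary.Any using (here; there)
import Data.List.Relation.Unary.Any as Any
open import Data.List.Relation.Unary.Any.Properties using (any⁺; any⁻)
import Data.List.Relation.Unary.All as All
open import Data.List.Relation.Unary.All.Properties as AllP using (all⁺; all⁻; all-filter)
open import Data.List.Extrema (DecTotalOrder.totalOrder ℚP.≤-decTotalOrder) using (argmin; argmin-all; f[argmin]≤f[xs]; min)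
open import Algebra.Bundles using (CommutativeRing)
open import Data.Maybe using (nothing)
open import Tactic.RingSolver.Core.AlmostCommutativeRing using (fromCommutativeRing)
import Tactic.RingSolver.NonReflective as NR

∧-intro : ∀ {a b} → a ≡ true → b ≡ true → a ∧ b ≡ true
∧-intro refl refl = refl

∧-elimˡ : ∀ {a b} → a ∧ b ≡ true → a ≡ true
∧-elimˡ {a} {b} = ∧-conicalˡ a b

∧-elimʳ : ∀ {a b} → a ∧ b ≡ true → b ≡ true
∧-elimʳ {a} {b} = ∧-conicalʳ a b

∧-swapʳ : ∀ a b c → (a ∧ b) ∧ c ≡ (a ∧ c) ∧ b
∧-swapʳ true b c = ∧-comm b c
∧-swapʳ false b c = refl

→ᵇ-intro : ∀ {a b} → (a ≡ true → b ≡ true) → not a ∨ b ≡ true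
→ᵇ-intro {true} f = f refl
→ᵇ-intro {false} f = refl

→ᵇ-elim : ∀ {a b} → not a ∨ b ≡ true → a ≡ true → b ≡ true
→ᵇ-elim h refl = h

false≢true : false ≢ true
false≢true ()

≡true-ext : ∀ {a b} → (a ≡ true → b ≡ true) → (b ≡ true → a ≡ true) → a ≡ b
≡true-ext f g = ⇔→≡ (mk⇔ f g)

≤ᵇ-complete : ∀ {m n} → m ≤ n → (m ℕ.≤ᵇ n) ≡ true
≤ᵇ-complete = Equivalence.to T-≡ ∘ ℕP.≤⇒≤ᵇ

≤ᵇ-sound : ∀ {m n} → (m ℕ.≤ᵇ n) ≡ true → m ≤ n
≤ᵇ-sound {m} {n} = ℕP.≤ᵇ⇒≤ m n ∘ Equivalence.from T-≡

<ᵇ-complete : ∀ {m n} → m < n → (m ℕ.<ᵇ n) ≡ true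
<ᵇ-complete = Equivalence.to T-≡ ∘ ℕP.<⇒<ᵇ

<ᵇ-sound : ∀ {m n} → (m ℕ.<ᵇ n) ≡ true → m < n
<ᵇ-sound {m} {n} = ℕP.<ᵇ⇒< m n ∘ Equivalence.from T-≡

<ᵇ-false : ∀ {m n} → ¬ m < n → (m ℕ.<ᵇ n) ≡ false
<ᵇ-false m≮n = ¬-not (m≮n ∘ <ᵇ-sound)

ℚ≤ᵇ-complete : ∀ {p q} → p ℚ.≤ q → (p ℚ.≤ᵇ q) ≡ true
ℚ≤ᵇ-complete = Equivalence.to T-≡ ∘ ℚP.≤⇒≤ᵇ

ℚ≤ᵇ-sound : ∀ {p q} → (p ℚ.≤ᵇ q) ≡ true → p ℚ.≤ q
ℚ≤ᵇ-sound = ℚP.≤ᵇ⇒≤ ∘ Equivalence.from T-≡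

module _ {A : Set} (p : A → Bool) where

  all-elim : ∀ {xs} → all p xs ≡ true → ∀ {x} → x ∈ xs → p x ≡ true
  all-elim {xs} h = Equivalence.to T-≡ ∘ All.lookup (all⁺ p xs (Equivalence.from T-≡ h))

  all-intro : ∀ xs → (∀ {x} → x ∈ xs → p x ≡ true) → all p xs ≡ true
  all-intro xs f = Equivalence.to T-≡ (all⁻ p (All.tabulate (Equivalence.from T-≡ ∘ f)))

  any-intro : ∀ {xs x} → x ∈ xs → p x ≡ true → any p xs ≡ true
  any-intro x∈ px = Equivalence.to T-≡ (any⁺ p (lose x∈ (Equivalence.from T-≡ px)))

  any-witness : ∀ xs → any p xs ≡ true → ∃[ x ] (x ∈ xs × p x ≡ true)
  any-witness xs h with find (any⁻ p xs (Equivalence.from T-≡ h))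
  ... | x , x∈ , px = x , x∈ , Equivalence.to T-≡ px

module _ {A : Set} where

  all-cong : ∀ {p q : A → Bool} xs → (∀ x → p x ≡ q x) → all p xs ≡ all q xs
  all-cong [] e = refl
  all-cong (y ∷ ys) e = cong₂ _∧_ (e y) (all-cong ys e)

  any-cong : ∀ {p q : A → Bool} xs → (∀ x → p x ≡ q x) → any p xs ≡ any q xs
  any-cong [] e = refl
  any-cong (y ∷ ys) e = cong₂ _∨_ (e y) (any-cong ys e)

∈-pairs : ∀ {n} (i j : Fin n) → (i , j) ∈ pairs n
∈-pairs i j = ∈-cartesianProduct⁺ (∈-allFin i) (∈-allFin j)

module _ {n : ℕ} where

  infix 4 _≐_
  infix 7 _⊆ᵇ_ _⊂ᵇ_
  infixr 9 _∩_
  infixr 8 _∪_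

  _≐_ : Subset n → Subset n → Set
  S ≐ B = ∀ i → S i ≡ B i

  ∅ : Subset n
  ∅ _ = false

  full : Subset n
  full _ = true

  _∩_ : Subset n → Subset n → Subset n
  (S ∩ B) i = S i ∧ B i

  _∪_ : Subset n → Subset n → Subset n
  (S ∪ B) i = S i ∨ B i

  ∁ : Subset n → Subset n
  ∁ S i = not (S i)

  -- Opaque, so that S and B can be inferred from S ⊆ᵇ B ≡ true.
  opaque
    _⊆ᵇ_ : Subset n → Subset n → Bool
    S ⊆ᵇ B = all (λ i → not (S i) ∨ B i) (allFin n)

    ⊆ᵇ-elim : ∀ {S B} → S ⊆ᵇ B ≡ true → ∀ i → S i ≡ true → B i ≡ true
    ⊆ᵇ-elim {S} {B} h i = →ᵇ-elim (all-elim (λ i → not (S i) ∨ B i) h (∈-allFin i))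

    ⊆ᵇ-intro : ∀ {S B} → (∀ i → S i ≡ true → B i ≡ true) → S ⊆ᵇ B ≡ true
    ⊆ᵇ-intro {S} {B} f = all-intro (λ i → not (S i) ∨ B i) (allFin n) (λ {i} _ → →ᵇ-intro (f i))

    ⊆ᵇ-false-witness : ∀ {S B} → S ⊆ᵇ B ≡ false → ∃[ i ] (S i ≡ true × B i ≡ false)
    ⊆ᵇ-false-witness {S} {B} S⊈B
      with FinP.¬∀⟶∃¬ n (λ i → not (S i) ∨ B i ≡ true) (λ i → not (S i) ∨ B i Bool.≟ true)
                       (λ S⊆B → false≢true (trans (sym S⊈B) (all-intro _ (allFin n) λ {i} _ → S⊆B i)))
    ... | i , ¬Si⇒Bi with S i in Si | B i in Bi
    ...   | true | false = i , Si , Bi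
    ...   | true | true = ⊥-elim (¬Si⇒Bi refl)
    ...   | false | _ = ⊥-elim (¬Si⇒Bi refl)

    ⊆ᵇ-congˡ : ∀ {S S′} B → S ≐ S′ → (S ⊆ᵇ B) ≡ (S′ ⊆ᵇ B)
    ⊆ᵇ-congˡ B e = all-cong (allFin n) (λ i → cong (λ b → not b ∨ B i) (e i))

    ⊆ᵇ-congʳ : ∀ S {B B′} → B ≐ B′ → (S ⊆ᵇ B) ≡ (S ⊆ᵇ B′)
    ⊆ᵇ-congʳ S e = all-cong (allFin n) (λ i → cong (not (S i) ∨_) (e i))

  _⊂ᵇ_ : Subset n → Subset n → Bool
  S ⊂ᵇ B = (S ⊆ᵇ B) ∧ not (B ⊆ᵇ S)

  ⊆ᵇ-antisym : ∀ {S B} → S ⊆ᵇ B ≡ true → B ⊆ᵇ S ≡ true → S ≐ B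
  ⊆ᵇ-antisym {S} {B} S⊆B B⊆S i = ≡true-ext (⊆ᵇ-elim {S} {B} S⊆B i) (⊆ᵇ-elim {B} {S} B⊆S i)

  ≐⇒⊆ᵇ : ∀ {S B} → S ≐ B → S ⊆ᵇ B ≡ true
  ≐⇒⊆ᵇ S≐B = ⊆ᵇ-intro (λ i Si → trans (sym (S≐B i)) Si)

  ⊂ᵇ-congʳ : ∀ S {B B′} → B ≐ B′ → (S ⊂ᵇ B) ≡ (S ⊂ᵇ B′)
  ⊂ᵇ-congʳ S e = cong₂ (λ a b → a ∧ not b) (⊆ᵇ-congʳ S e) (⊆ᵇ-congˡ S e)

  ⊂ᵇ-intro : ∀ {S B} → S ⊆ᵇ B ≡ true → ∀ i → B i ≡ true → S i ≡ false → S ⊂ᵇ B ≡ true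
  ⊂ᵇ-intro {S} {B} S⊆B i Bi Si = ∧-intro S⊆B (cong not (¬-not B⊈S))
    where
    B⊈S : B ⊆ᵇ S ≢ true
    B⊈S B⊆S = false≢true (trans (sym Si) (⊆ᵇ-elim {B} {S} B⊆S i Bi))

  ⊂ᵇ-witness : ∀ {S B} → S ⊂ᵇ B ≡ true → ∃[ i ] (B i ≡ true × S i ≡ false)
  ⊂ᵇ-witness {S} {B} h = ⊆ᵇ-false-witness (not-injective (∧-elimʳ {S ⊆ᵇ B} h))

  ⊆ᵇ∩⇒⊆ᵇʳ : ∀ {S B M} → S ⊆ᵇ B ∩ M ≡ true → S ⊆ᵇ M ≡ true
  ⊆ᵇ∩⇒⊆ᵇʳ {B = B} S⊆B∩M = ⊆ᵇ-intro λ j Sj → ∧-elimʳ {B j} (⊆ᵇ-elim S⊆B∩M j Sj)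

  ⊂ᵇ≡⊆ᵇ∩ : ∀ {S B M} → S ⊆ᵇ M ≡ true → ∀ i → B i ≡ true → M i ≡ false → S ⊂ᵇ B ≡ S ⊆ᵇ B ∩ M
  ⊂ᵇ≡⊆ᵇ∩ S⊆M i Bi Mi = ≡true-ext
    (λ S⊂B → ⊆ᵇ-intro λ j Sj → ∧-intro (⊆ᵇ-elim (∧-elimˡ S⊂B) j Sj) (⊆ᵇ-elim S⊆M j Sj))
    (λ S⊆B∩M → ⊂ᵇ-intro (⊆ᵇ-intro λ j Sj → ∧-elimˡ (⊆ᵇ-elim S⊆B∩M j Sj)) i Bi
                         (¬-not λ Si → false≢true (trans (sym Mi) (⊆ᵇ-elim S⊆M i Si))))

size : ∀ {n} → Subset n → ℕ
size {zero} S = 0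
size {suc n} S = (if S Fin.zero then 1 else 0) ℕ.+ size (S ∘ Fin.suc)

size-bound : ∀ {n} (S : Subset n) → size S ≤ n
size-bound {zero} S = z≤n
size-bound {suc n} S with S Fin.zero
... | true = s≤s (size-bound _)
... | false = ℕP.m≤n⇒m≤1+n (size-bound _)

size-mono : ∀ {n} {S B : Subset n} → (∀ i → S i ≡ true → B i ≡ true) → size S ≤ size B
size-mono {zero} f = z≤n
size-mono {suc n} {S} {B} f with S Fin.zero in S0 | B Fin.zero in B0
... | false | false = size-mono (f ∘ Fin.suc)
... | false | true = ℕP.m≤n⇒m≤1+n (size-mono (f ∘ Fin.suc))
... | true | true = s≤s (size-mono (f ∘ Fin.suc))
... | true | false = ⊥-elim (false≢true (trans (sym B0) (f Fin.zero S0)))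

size-strict : ∀ {n} {S B : Subset n} → (∀ i → S i ≡ true → B i ≡ true) →
  ∀ i → B i ≡ true → S i ≡ false → size S < size B
size-strict f Fin.zero Bi Si rewrite Bi | Si = s≤s (size-mono (f ∘ Fin.suc))
size-strict {suc n} {S} {B} f (Fin.suc i) Bi Si with S Fin.zero in S0 | B Fin.zero in B0
... | false | false = size-strict (f ∘ Fin.suc) i Bi Si
... | false | true = ℕP.m≤n⇒m≤1+n (size-strict (f ∘ Fin.suc) i Bi Si)
... | true | true = s≤s (size-strict (f ∘ Fin.suc) i Bi Si)
... | true | false = ⊥-elim (false≢true (trans (sym B0) (f Fin.zero S0)))

size-pos : ∀ {n} {S : Subset n} i → S i ≡ true → 1 ≤ size S
size-pos i Si = ℕP.≤-trans (s≤s z≤n) (size-strict {S = ∅} (λ _ ()) i Si refl)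

⊂ᵇ-size : ∀ {n} {S B : Subset n} → S ⊂ᵇ B ≡ true → size S < size B
⊂ᵇ-size {S = S} {B} h with ⊂ᵇ-witness {S = S} h
... | i , Bi , Si = size-strict (⊆ᵇ-elim (∧-elimˡ h)) i Bi Si

⊂ᵇ-size-≤ : ∀ {n} {S B : Subset n} {k} → S ⊂ᵇ B ≡ true → size B ≤ suc k → size S ≤ k
⊂ᵇ-size-≤ {S = S} {B} S⊂B B≤ = ℕP.≤-pred (ℕP.<-≤-trans (⊂ᵇ-size {S = S} {B} S⊂B) B≤)

allSubsets-complete : ∀ {n} (S : Subset n) → ∃[ S′ ] (S′ ∈ allSubsets n × S′ ≐ S)
allSubsets-complete {zero} S = (λ ()) , here refl , (λ ())
allSubsets-complete {suc n} S with allSubsets-complete (S ∘ Fin.suc)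
... | S′ , S′∈ , S′≐ =
  consS (S Fin.zero) S′ ,
  ∈-concatMap⁺ (λ T → consS false T ∷ consS true T ∷ []) (Any.map (λ { refl → ∈-pair (S Fin.zero) }) S′∈) ,
  cons≐
  where
  ∈-pair : ∀ b → consS b S′ ∈ (consS false S′ ∷ consS true S′ ∷ [])
  ∈-pair false = here refl
  ∈-pair true = there (here refl)
  cons≐ : consS (S Fin.zero) S′ ≐ S
  cons≐ Fin.zero = refl
  cons≐ (Fin.suc i) = S′≐ i

-- The pairings ⟨h, λ_S⟩

module _ {A : Set} where

  sumℚ-cong : ∀ {f g : A → ℚ} xs → (∀ x → f x ≡ g x) → sumℚ (map f xs) ≡ sumℚ (map g xs)
  sumℚ-cong [] e = refl
  sumℚ-cong (x ∷ xs) e = cong₂ ℚ._+_ (e x) (sumℚ-cong xs e)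

  sumℚ-+ : ∀ (f g : A → ℚ) xs → sumℚ (map (λ x → f x ℚ.+ g x) xs) ≡ sumℚ (map f xs) ℚ.+ sumℚ (map g xs)
  sumℚ-+ f g [] = refl
  sumℚ-+ f g (x ∷ xs) = trans (cong (f x ℚ.+ g x ℚ.+_) (sumℚ-+ f g xs))
    (solve 4 (λ a b c d → (a :+ b) :+ (c :+ d) := (a :+ c) :+ (b :+ d)) refl (f x) (g x) _ _)
    where open +-*-Solver

  sumℚ-scale : ∀ c (f : A → ℚ) xs → sumℚ (map (λ x → c ℚ.* f x) xs) ≡ c ℚ.* sumℚ (map f xs)
  sumℚ-scale c f [] = sym (ℚP.*-zeroʳ c)
  sumℚ-scale c f (x ∷ xs) = trans (cong (c ℚ.* f x ℚ.+_) (sumℚ-scale c f xs)) (sym (ℚP.*-distribˡ-+ c (f x) _))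

  sumℚ-neg : ∀ (f : A → ℚ) xs → sumℚ (map (λ x → ℚ.- f x) xs) ≡ ℚ.- sumℚ (map f xs)
  sumℚ-neg f [] = refl
  sumℚ-neg f (x ∷ xs) = trans (cong (ℚ.- f x ℚ.+_) (sumℚ-neg f xs)) (sym (ℚP.neg-distrib-+ (f x) _))

  sumℚ-zero : ∀ (xs : List A) → sumℚ (map (λ _ → 0ℚ) xs) ≡ 0ℚ
  sumℚ-zero [] = refl
  sumℚ-zero (x ∷ xs) = trans (ℚP.+-identityˡ _) (sumℚ-zero xs)

  sumℚ-mono : ∀ {f g : A → ℚ} xs → (∀ x → f x ℚ.≤ g x) → sumℚ (map f xs) ℚ.≤ sumℚ (map g xs)
  sumℚ-mono [] f≤g = ℚP.≤-refl
  sumℚ-mono (x ∷ xs) f≤g = ℚP.+-mono-≤ (f≤g x) (sumℚ-mono xs f≤g)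

sumℚ-tabulate-single : ∀ {n} (f : Fin n → ℚ) a → (∀ i → i ≢ a → f i ≡ 0ℚ) → sumℚ (tabulate f) ≡ f a
sumℚ-tabulate-single {suc n} f Fin.zero f≡0 =
  trans (cong (f Fin.zero ℚ.+_) (trans (cong sumℚ (ListP.tabulate-cong (λ i → f≡0 (Fin.suc i) (λ ())))) (zeros n)))
        (ℚP.+-identityʳ _)
  where
  zeros : ∀ n → sumℚ (tabulate {n = n} (λ _ → 0ℚ)) ≡ 0ℚ
  zeros zero = refl
  zeros (suc n) = trans (ℚP.+-identityˡ _) (zeros n)
sumℚ-tabulate-single {suc n} f (Fin.suc a) f≡0 =
  trans (cong₂ ℚ._+_ (f≡0 Fin.zero (λ ()))
                     (sumℚ-tabulate-single (f ∘ Fin.suc) a (λ i i≢a → f≡0 (Fin.suc i) (i≢a ∘ FinP.suc-injective))))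
        (ℚP.+-identityˡ _)

p≤∣p∣ : ∀ p → p ℚ.≤ ℚ.∣ p ∣
p≤∣p∣ p with ℚP.≤-total 0ℚ p
... | inj₁ 0≤p = ℚP.≤-reflexive (sym (ℚP.0≤p⇒∣p∣≡p 0≤p))
... | inj₂ p≤0 = ℚP.≤-trans p≤0 (ℚP.0≤∣p∣ p)

<⇒≱ : ∀ {p q} → p ℚ.< q → ¬ q ℚ.≤ p
<⇒≱ p<q q≤p = ℚP.<-irrefl refl (ℚP.<-≤-trans p<q q≤p)

≤-from-sum : ∀ {a b c d} → a ℚ.+ b ≡ c ℚ.+ d → d ℚ.≤ b → a ℚ.≤ c
≤-from-sum {a} {b} {c} {d} a+b≡c+d d≤b = begin
  a                    ≡⟨ solve 2 (λ a b → a := (a :+ b) :- b) refl a b ⟩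
  (a ℚ.+ b) ℚ.- b      ≡⟨ cong (ℚ._- b) a+b≡c+d ⟩
  (c ℚ.+ d) ℚ.- b      ≤⟨ ℚP.+-monoˡ-≤ (ℚ.- b) (ℚP.+-monoʳ-≤ c d≤b) ⟩
  (c ℚ.+ b) ℚ.- b      ≡⟨ solve 2 (λ c b → (c :+ b) :- b := c) refl c b ⟩
  c                    ∎
  where
  open ℚP.≤-Reasoning
  open +-*-Solver

neg-positive⇒negative : ∀ {p} → 0ℚ ℚ.< ℚ.- p → p ℚ.< 0ℚ
neg-positive⇒negative {p} 0<-p = subst (ℚ._< 0ℚ) (solve 1 (λ p → :- (:- p) := p) refl p) (ℚP.neg-antimono-< 0<-p)
  where open +-*-Solver

module _ {n : ℕ} where

  pairing-cong : ∀ {S S′ : Subset n} h → S ≐ S′ → pairingST S h ≡ pairingST S′ h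
  pairing-cong h e = sumℚ-cong (allFin n) (λ i → cong (λ b → if b then h i else 0ℚ) (e i))

  pairing-∅ : ∀ (h : Fin n → ℚ) → pairingST ∅ h ≡ 0ℚ
  pairing-∅ h = sumℚ-zero (allFin n)

  pairing-modular : ∀ (S M : Subset n) h →
    pairingST (S ∩ M) h ℚ.+ pairingST (S ∪ M) h ≡ pairingST S h ℚ.+ pairingST M h
  pairing-modular S M h = trans (sym (sumℚ-+ _ _ (allFin n))) (trans (sumℚ-cong (allFin n) pointwise) (sumℚ-+ _ _ (allFin n)))
    where
    pointwise : ∀ i → (if S i ∧ M i then h i else 0ℚ) ℚ.+ (if S i ∨ M i then h i else 0ℚ)
                    ≡ (if S i then h i else 0ℚ) ℚ.+ (if M i then h i else 0ℚ)
    pointwise i with S i | M i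
    ... | true | true = refl
    ... | true | false = trans (ℚP.+-identityˡ (h i)) (sym (ℚP.+-identityʳ (h i)))
    ... | false | true = refl
    ... | false | false = refl

  pairing-∁ : ∀ (S : Subset n) h → pairingST (∁ S) h ℚ.+ pairingST S h ≡ totalSum h
  pairing-∁ S h = trans (sym (sumℚ-+ _ _ (allFin n))) (sumℚ-cong (allFin n) pointwise)
    where
    pointwise : ∀ i → (if not (S i) then h i else 0ℚ) ℚ.+ (if S i then h i else 0ℚ) ≡ h i
    pointwise i with S i
    ... | true = ℚP.+-identityˡ (h i)
    ... | false = ℚP.+-identityʳ (h i)

  pairing-+ : ∀ (S : Subset n) f g → pairingST S (λ i → f i ℚ.+ g i) ≡ pairingST S f ℚ.+ pairingST S g
  pairing-+ S f g = trans (sumℚ-cong (allFin n) pointwise) (sumℚ-+ _ _ (allFin n))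
    where
    pointwise : ∀ i → (if S i then f i ℚ.+ g i else 0ℚ) ≡ (if S i then f i else 0ℚ) ℚ.+ (if S i then g i else 0ℚ)
    pointwise i with S i
    ... | true = refl
    ... | false = refl

  pairing-scale : ∀ (S : Subset n) c f → pairingST S (λ i → c ℚ.* f i) ≡ c ℚ.* pairingST S f
  pairing-scale S c f = trans (sumℚ-cong (allFin n) pointwise) (sumℚ-scale c _ (allFin n))
    where
    pointwise : ∀ i → (if S i then c ℚ.* f i else 0ℚ) ≡ c ℚ.* (if S i then f i else 0ℚ)
    pointwise i with S i
    ... | true = refl
    ... | false = sym (ℚP.*-zeroʳ c)

  pairing-neg : ∀ (S : Subset n) f → pairingST S (λ i → ℚ.- f i) ≡ ℚ.- pairingST S f
  pairing-neg S f = trans (sumℚ-cong (allFin n) pointwise) (sumℚ-neg _ (allFin n))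
    where
    pointwise : ∀ i → (if S i then ℚ.- f i else 0ℚ) ≡ ℚ.- (if S i then f i else 0ℚ)
    pointwise i with S i
    ... | true = refl
    ... | false = refl

  pairing-- : ∀ (S : Subset n) f g → pairingST S (λ i → f i ℚ.- g i) ≡ pairingST S f ℚ.- pairingST S g
  pairing-- S f g = trans (pairing-+ S f (λ i → ℚ.- g i)) (cong (pairingST S f ℚ.+_) (pairing-neg S g))

  pairing-≤-∑∣∣ : ∀ (S : Subset n) y → pairingST S y ℚ.≤ sumℚ (map (λ i → ℚ.∣ y i ∣) (allFin n))
  pairing-≤-∑∣∣ S y = sumℚ-mono (allFin n) pointwise
    where
    pointwise : ∀ i → (if S i then y i else 0ℚ) ℚ.≤ ℚ.∣ y i ∣
    pointwise i with S i
    ... | true = p≤∣p∣ (y i)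
    ... | false = ℚP.0≤∣p∣ (y i)

bitℚ : Bool → ℚ
bitℚ b = if b then 1ℚ else 0ℚ

δ : ∀ {n} → Fin n → Fin n → ℚ
δ a i = bitℚ ⌊ i Fin.≟ a ⌋

pairing-δ : ∀ {n} (S : Subset n) a → pairingST S (δ a) ≡ bitℚ (S a)
pairing-δ {n} S a = begin
  pairingST S (δ a)                                  ≡⟨ cong sumℚ (ListP.map-tabulate {n = n} (λ i → i) _) ⟩
  sumℚ (tabulate (λ i → if S i then δ a i else 0ℚ))  ≡⟨ sumℚ-tabulate-single _ a off-a ⟩
  (if S a then δ a a else 0ℚ)                         ≡⟨ at-a (S a) ⟩
  bitℚ (S a)                                         ∎
  where
  open ≡-Reasoning
  off-a : ∀ i → i ≢ a → (if S i then δ a i else 0ℚ) ≡ 0ℚ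
  off-a i i≢a with i Fin.≟ a | S i
  ... | yes i≡a | _ = ⊥-elim (i≢a i≡a)
  ... | no _ | true = refl
  ... | no _ | false = refl
  at-a : ∀ b → (if b then δ a a else 0ℚ) ≡ bitℚ b
  at-a false = refl
  at-a true with a Fin.≟ a
  ... | yes _ = refl
  ... | no a≢a = ⊥-elim (a≢a refl)

pairing-perturb : ∀ {n} (S : Subset n) h y ε →
  pairingST S (λ i → h i ℚ.+ ε ℚ.* (h i ℚ.- y i)) ≡ pairingST S h ℚ.+ ε ℚ.* (pairingST S h ℚ.- pairingST S y)
pairing-perturb S h y ε =
  trans (pairing-+ S h _) (cong (pairingST S h ℚ.+_) (trans (pairing-scale S ε _) (cong (ε ℚ.*_) (pairing-- S h y))))

-- Upsets and braid cones at integer points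

opaque
  fromℕ : ℕ → ℚ
  fromℕ m = mkℚ (+ m) 0 (Coprime.sym (1-coprimeTo m))

  fromℕ-≤ᵇ : ∀ m n → (fromℕ m ℚ.≤ᵇ fromℕ n) ≡ (m ℕ.≤ᵇ n)
  fromℕ-≤ᵇ m n rewrite ℕP.*-identityʳ m | ℕP.*-identityʳ n | ℤP.+◃n≡+n m | ℤP.+◃n≡+n n = refl

fromℕ-mono-≤ : ∀ {m n} → m ≤ n → fromℕ m ℚ.≤ fromℕ n
fromℕ-mono-≤ {m} {n} m≤n = ℚ≤ᵇ-sound (trans (fromℕ-≤ᵇ m n) (≤ᵇ-complete m≤n))

fromℕ-cancel-≤ : ∀ {m n} → fromℕ m ℚ.≤ fromℕ n → m ≤ n
fromℕ-cancel-≤ {m} {n} le = ≤ᵇ-sound (trans (sym (fromℕ-≤ᵇ m n)) (ℚ≤ᵇ-complete le))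

bit : Bool → ℕ
bit b = if b then 1 else 0

module _ {n : ℕ} where

  toℚ : (Fin n → ℕ) → Fin n → ℚ
  toℚ μ = fromℕ ∘ μ

  0ᵛ : Fin n → ℕ
  0ᵛ _ = 0

  raise : Subset n → (Fin n → ℕ) → Fin n → ℕ
  raise S μ i = bit (S i) ℕ.+ μ i

  _+ᵛ_ : (Fin n → ℕ) → (Fin n → ℕ) → Fin n → ℕ
  (μ +ᵛ μ′) i = μ i ℕ.+ μ′ i

  SupportedIn : (Fin n → ℕ) → Subset n → Set
  SupportedIn μ B = ∀ i → B i ≡ false → μ i ≡ 0

  raise-supportedIn : ∀ {S B μ} → S ⊆ᵇ B ≡ true → SupportedIn μ S → SupportedIn (raise S μ) B
  raise-supportedIn {S} {B} S⊆B μ∈S i Bi with S i in Si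
  ... | true = ⊥-elim (false≢true (trans (sym Bi) (⊆ᵇ-elim {S = S} {B} S⊆B i Si)))
  ... | false = μ∈S i Si

  upPair : BRel n → Subset n → Fin n × Fin n → Bool
  upPair r S ij = not (r (proj₂ ij) (proj₁ ij) ∧ S (proj₁ ij)) ∨ S (proj₂ ij)

  conePair : BRel n → (Fin n → ℚ) → Fin n × Fin n → Bool
  conePair r x ij = not (r (proj₁ ij) (proj₂ ij)) ∨ (x (proj₂ ij) ℚ.≤ᵇ x (proj₁ ij))

  upClosed-elim : ∀ {r S} → upClosed r S ≡ true → ∀ {i j} → S i ≡ true → r j i ≡ true → S j ≡ true
  upClosed-elim {r} {S} up {i} {j} Si rji = →ᵇ-elim (all-elim (upPair r S) up (∈-pairs i j)) (∧-intro rji Si)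

  upClosed-intro : ∀ {r S} → (∀ {i j} → S i ≡ true → r j i ≡ true → S j ≡ true) → upClosed r S ≡ true
  upClosed-intro {r} {S} f =
    all-intro (upPair r S) (pairs n) λ { {i , j} _ → →ᵇ-intro (λ c → f (∧-elimʳ {r j i} c) (∧-elimˡ c)) }

  upClosed-cong : ∀ r {S S′} → S ≐ S′ → upClosed r S ≡ upClosed r S′
  upClosed-cong r e = all-cong (pairs n) λ { (i , j) → cong₂ (λ a b → not (r j i ∧ a) ∨ b) (e i) (e j) }

  inBraidCone : BRel n → (Fin n → ℚ) → Bool
  inBraidCone r x = all (conePair r x) (pairs n)

  inBraidCone-elim : ∀ {r x} → inBraidCone r x ≡ true → ∀ {i j} → r i j ≡ true → (x j ℚ.≤ᵇ x i) ≡ true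
  inBraidCone-elim {r} {x} h {i} {j} = →ᵇ-elim (all-elim (conePair r x) h (∈-pairs i j))

  inBraidCone-intro : ∀ {r x} → (∀ {i j} → r i j ≡ true → (x j ℚ.≤ᵇ x i) ≡ true) → inBraidCone r x ≡ true
  inBraidCone-intro {r} {x} f = all-intro (conePair r x) (pairs n) λ { {i , j} _ → →ᵇ-intro f }

  inBraidCone-toℚ : ∀ {r μ} → inBraidCone r (toℚ μ) ≡ true ⇔ (∀ {i j} → r i j ≡ true → μ j ≤ μ i)
  inBraidCone-toℚ {r} {μ} = mk⇔
    (λ h {i} {j} rij → ≤ᵇ-sound (trans (sym (fromℕ-≤ᵇ (μ j) (μ i))) (inBraidCone-elim {r} {toℚ μ} h rij)))
    (λ f → inBraidCone-intro {r} {toℚ μ} (λ {i} {j} rij → trans (fromℕ-≤ᵇ (μ j) (μ i)) (≤ᵇ-complete (f rij))))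

  inBraidCone-0ᵛ : ∀ r → inBraidCone r (toℚ 0ᵛ) ≡ true
  inBraidCone-0ᵛ r = Equivalence.from (inBraidCone-toℚ {r} {0ᵛ}) (λ _ → z≤n)

  inBraidCone-raise : ∀ r {S μ} → SupportedIn μ S →
    inBraidCone r (toℚ (raise S μ)) ≡ upClosed r S ∧ inBraidCone r (toℚ μ)
  inBraidCone-raise r {S} {μ} μ∈S = ≡true-ext fwd bwd
    where
    fwd : inBraidCone r (toℚ (raise S μ)) ≡ true → upClosed r S ∧ inBraidCone r (toℚ μ) ≡ true
    fwd h = ∧-intro (upClosed-intro up) (Equivalence.from inBraidCone-toℚ cone)
      where
      le : ∀ {i j} → r i j ≡ true → raise S μ j ≤ raise S μ i
      le = Equivalence.to inBraidCone-toℚ h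
      up : ∀ {i j} → S i ≡ true → r j i ≡ true → S j ≡ true
      up {i} {j} Si rji with S j in Sj | le rji
      ... | true | _ = refl
      ... | false | i≤j rewrite Si | μ∈S j Sj with i≤j
      ...   | ()
      cone : ∀ {i j} → r i j ≡ true → μ j ≤ μ i
      cone {i} {j} rij with S i in Si | S j in Sj | le rij
      ... | true | true | s≤s j≤i = j≤i
      ... | _ | false | _ rewrite μ∈S j Sj = z≤n
      ... | false | true | j≤i rewrite μ∈S i Si with j≤i
      ...   | ()
    bwd : upClosed r S ∧ inBraidCone r (toℚ μ) ≡ true → inBraidCone r (toℚ (raise S μ)) ≡ true
    bwd h = Equivalence.from inBraidCone-toℚ le
      where
      le : ∀ {i j} → r i j ≡ true → raise S μ j ≤ raise S μ i
      le {i} {j} rij with S i in Si | S j in Sj | Equivalence.to inBraidCone-toℚ (∧-elimʳ {upClosed r S} h) rij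
      ... | true | true | j≤i = s≤s j≤i
      ... | false | true | _ = ⊥-elim (false≢true (trans (sym Si) (upClosed-elim {r} {S} (∧-elimˡ h) Sj rij)))
      ... | true | false | j≤i = ℕP.m≤n⇒m≤1+n j≤i
      ... | false | false | j≤i = j≤i

module _ {n : ℕ} where

  upClosed-∅ : ∀ r → upClosed r (∅ {n}) ≡ true
  upClosed-∅ r = upClosed-intro {r = r} (λ ())

  upClosed-full : ∀ r → upClosed r (full {n}) ≡ true
  upClosed-full r = upClosed-intro {r = r} (λ _ _ → refl)

  upClosed-∩ : ∀ r {S B : Subset n} → upClosed r S ≡ true → upClosed r B ≡ true → upClosed r (S ∩ B) ≡ true
  upClosed-∩ r {S} {B} upS upB = upClosed-intro {r = r} (λ {i} SBi rji →
    ∧-intro (upClosed-elim {r = r} {S = S} upS (∧-elimˡ SBi) rji) (upClosed-elim {r = r} {S = B} upB (∧-elimʳ {S i} SBi) rji))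

  upClosed-∪ : ∀ r {S B : Subset n} → upClosed r S ≡ true → upClosed r B ≡ true → upClosed r (S ∪ B) ≡ true
  upClosed-∪ r {S} {B} upS upB = upClosed-intro {r = r} go
    where
    go : ∀ {i j} → S i ∨ B i ≡ true → r j i ≡ true → S j ∨ B j ≡ true
    go {i} {j} SBi rji with S i in Si
    ... | true = cong (_∨ B j) (upClosed-elim {r = r} {S = S} upS Si rji)
    ... | false = trans (cong (S j ∨_) (upClosed-elim {r = r} {S = B} upB SBi rji)) (∨-zeroʳ (S j))

  twoLump-intro : ∀ {S : Subset n} i j → S i ≡ true → S j ≡ false → twoLump S ≡ true
  twoLump-intro {S} i j Si Sj = ∧-intro (any-intro S (∈-allFin i) Si) (any-intro (not ∘ S) (∈-allFin j) (cong not Sj))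

module _ {n : ℕ} (h : Fin n → ℚ) where

  opaque
    negative : Subset n → Bool
    negative S = not (0ℚ ℚ.≤ᵇ pairingST S h)

    negative-sound : ∀ {S} → negative S ≡ true → pairingST S h ℚ.< 0ℚ
    negative-sound neg = ℚP.≰⇒> (λ 0≤ → false≢true (trans (sym (not-injective neg)) (ℚ≤ᵇ-complete 0≤)))

    negative-complete : ∀ {S} → pairingST S h ℚ.< 0ℚ → negative S ≡ true
    negative-complete <0 = cong not (¬-not (λ 0≤ → <⇒≱ <0 (ℚ≤ᵇ-sound 0≤)))

    negative-false : ∀ {S} → negative S ≡ false → 0ℚ ℚ.≤ pairingST S h
    negative-false nonneg = ℚ≤ᵇ-sound (not-injective nonneg)

    negative-cong : ∀ {S S′} → S ≐ S′ → negative S ≡ negative S′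
    negative-cong e = cong (λ q → not (0ℚ ℚ.≤ᵇ q)) (pairing-cong h e)

  negative-nonempty : ∀ {S} → negative S ≡ true → ∃[ i ] S i ≡ true
  negative-nonempty {S} neg with FinP.¬∀⟶∃¬ n (λ i → S i ≡ false) (λ i → S i Bool.≟ false) S≢∅
    where
    S≢∅ : ¬ (∀ i → S i ≡ false)
    S≢∅ S≐∅ = ℚP.<-irrefl (trans (pairing-cong h S≐∅) (pairing-∅ h)) (negative-sound neg)
  ... | i , Si≢false = i , ¬-not Si≢false

  negative-proper : totalSum h ≡ 0ℚ → ∀ {S} → negative S ≡ true → ∃[ i ] S i ≡ false
  negative-proper h0 {S} neg with FinP.¬∀⟶∃¬ n (λ i → S i ≡ true) (λ i → S i Bool.≟ true) S≢full
    where
    S≢full : ¬ (∀ i → S i ≡ true)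
    S≢full S≐full = ℚP.<-irrefl (trans (pairing-cong h S≐full) h0) (negative-sound neg)
  ... | i , Si≢true = i , ¬-not Si≢true

  negative-twoLump : totalSum h ≡ 0ℚ → ∀ {S} → negative S ≡ true → twoLump S ≡ true
  negative-twoLump h0 neg with negative-nonempty neg | negative-proper h0 neg
  ... | i , Si | j , Sj = twoLump-intro i j Si Sj

  module Minimiser (r : BRel n) where

    upsets : List (Subset n)
    upsets = filter (λ S → upClosed r S Bool.≟ true) (allSubsets n)

    opaque
      M : Subset n
      M = argmin (λ S → pairingST S h) ∅ upsets

      M-upClosed : upClosed r M ≡ true
      M-upClosed = argmin-all (λ S → pairingST S h) (upClosed-∅ r) (all-filter (λ S → upClosed r S Bool.≟ true) (allSubsets n))

      M-minimal : ∀ {S} → upClosed r S ≡ true → pairingST M h ℚ.≤ pairingST S h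
      M-minimal {S} upS with allSubsets-complete S
      ... | S′ , S′∈ , S′≐S = subst (pairingST M h ℚ.≤_) (pairing-cong h S′≐S)
        (All.lookup (f[argmin]≤f[xs] ∅ upsets)
                    (∈-filter⁺ (λ S → upClosed r S Bool.≟ true) S′∈ (trans (upClosed-cong r S′≐S) upS)))

    ∩M-negative : ∀ {S} → upClosed r S ≡ true → negative S ≡ true → negative (S ∩ M) ≡ true
    ∩M-negative {S} upS neg = negative-complete (ℚP.≤-<-trans ∩M≤S (negative-sound neg))
      where
      ∩M≤S : pairingST (S ∩ M) h ℚ.≤ pairingST S h
      ∩M≤S = ≤-from-sum (pairing-modular S M h) (M-minimal (upClosed-∪ r upS M-upClosed))

-- Dual cones and their relative interiors

module _ {n : ℕ} where

  twoLump-cong : ∀ {S S′ : Subset n} → S ≐ S′ → twoLump S ≡ twoLump S′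
  twoLump-cong e = cong₂ _∧_ (any-cong (allFin n) e) (any-cong (allFin n) (cong not ∘ e))

  dualCondition : BRel n → (Fin n → ℚ) → Subset n → Bool
  dualCondition r y S = not (upClosed r S ∧ twoLump S) ∨ (0ℚ ℚ.≤ᵇ pairingST S y)

  inDualCone-sum : ∀ {r : BRel n} {y : Fin n → ℚ} → inDualCone r y ≡ true → totalSum y ≡ 0ℚ
  inDualCone-sum {y = y} y∈ = toWitness {a? = totalSum y ℚP.≟ 0ℚ} (Equivalence.from T-≡ (∧-elimˡ y∈))

  inDualCone-elim : ∀ {r : BRel n} {y : Fin n → ℚ} {S} → inDualCone r y ≡ true →
    upClosed r S ≡ true → twoLump S ≡ true → 0ℚ ℚ.≤ pairingST S y
  inDualCone-elim {r} {y} {S} y∈ upS tlS with allSubsets-complete S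
  ... | S′ , S′∈ , S′≐S = subst (0ℚ ℚ.≤_) (pairing-cong y S′≐S) (ℚ≤ᵇ-sound (→ᵇ-elim
        (all-elim (dualCondition r y) (∧-elimʳ {⌊ totalSum y ℚP.≟ 0ℚ ⌋} y∈) S′∈)
        (∧-intro (trans (upClosed-cong r S′≐S) upS) (trans (twoLump-cong S′≐S) tlS))))

  inDualCone-intro : ∀ {r : BRel n} {y : Fin n → ℚ} → totalSum y ≡ 0ℚ →
    (∀ {S} → upClosed r S ≡ true → twoLump S ≡ true → 0ℚ ℚ.≤ pairingST S y) → inDualCone r y ≡ true
  inDualCone-intro {r} {y} Σ≡0 f = ∧-intro (Equivalence.to T-≡ (fromWitness Σ≡0))
    (all-intro (dualCondition r y) (allSubsets n) λ {S} _ →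
      →ᵇ-intro λ c → ℚ≤ᵇ-complete (f (∧-elimˡ c) (∧-elimʳ {upClosed r S} c)))

  inDualCone-false : ∀ {r : BRel n} {y : Fin n → ℚ} {S} → upClosed r S ≡ true → twoLump S ≡ true →
    pairingST S y ℚ.< 0ℚ → inDualCone r y ≡ false
  inDualCone-false {r} {y} {S} upS tlS S<0 = ¬-not λ y∈ → <⇒≱ S<0 (inDualCone-elim {r} {y} {S} y∈ upS tlS)

module _ {n : ℕ} {r : BRel n} where

  -- If ⟨S, h⟩ were 0, moving from h away from y would leave the cone.
  relint-positive : ∀ {h y S} → RelIntDualCone r h → inDualCone r y ≡ true → upClosed r S ≡ true → twoLump S ≡ true →
    0ℚ ℚ.< pairingST S y → 0ℚ ℚ.< pairingST S h
  relint-positive {h} {y} {S} (h∈ , prolong) y∈ upS tlS 0<yS = ℚP.≰⇒> hS≰0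
    where
    hS≰0 : ¬ pairingST S h ℚ.≤ 0ℚ
    hS≰0 hS≤0 with prolong y y∈
    ... | ε , 0<ε , h′∈ = <⇒≱ h′S<0 (inDualCone-elim {r = r} h′∈ upS tlS)
      where
      hS≡0 : pairingST S h ≡ 0ℚ
      hS≡0 = ℚP.≤-antisym hS≤0 (inDualCone-elim {r = r} h∈ upS tlS)
      h′S<0 : pairingST S (λ i → h i ℚ.+ ε ℚ.* (h i ℚ.- y i)) ℚ.< 0ℚ
      h′S<0 = subst (ℚ._< 0ℚ)
        (sym (trans (pairing-perturb S h y ε) (trans (cong (λ q → q ℚ.+ ε ℚ.* (q ℚ.- pairingST S y)) hS≡0)
          (solve 2 (λ e z → con 0ℚ :+ e :* (con 0ℚ :- z) := :- (e :* z)) refl ε (pairingST S y)))))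
        (ℚP.neg-antimono-< (ℚP.positive⁻¹ _ {{ℚP.pos*pos⇒pos ε {{ℚ.positive 0<ε}} _ {{ℚ.positive 0<yS}}}}))
        where open +-*-Solver

  -- With ε = m / (1 + Σᵢ |yᵢ|) one has ε ⟨S, y⟩ ≤ m ≤ ⟨S, h⟩ on every facet S.
  prolong : ∀ {h y m} → 0ℚ ℚ.< m → totalSum h ≡ 0ℚ →
    (∀ {S} → upClosed r S ≡ true → twoLump S ≡ true → m ℚ.≤ pairingST S h) → inDualCone r y ≡ true →
    ∃[ ε ] (0ℚ ℚ.< ε × inDualCone r (λ i → h i ℚ.+ ε ℚ.* (h i ℚ.- y i)) ≡ true)
  prolong {h} {y} {m} 0<m Σh≡0 m≤ y∈ = ε , 0<ε , inDualCone-intro {r = r} Σ≡0 nonneg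
    where
    open +-*-Solver
    Y : ℚ
    Y = sumℚ (map (λ i → ℚ.∣ y i ∣) (allFin n))
    0≤Y : 0ℚ ℚ.≤ Y
    0≤Y = subst (ℚ._≤ Y) (sumℚ-zero (allFin n)) (sumℚ-mono (allFin n) (λ i → ℚP.0≤∣p∣ (y i)))
    d : ℚ
    d = 1ℚ ℚ.+ Y
    0<d : 0ℚ ℚ.< d
    0<d = ℚP.<-≤-trans (ℚP.positive⁻¹ 1ℚ) (subst (ℚ._≤ d) (ℚP.+-identityʳ 1ℚ) (ℚP.+-monoʳ-≤ 1ℚ 0≤Y))
    instance
      d≢0 : ℚ.NonZero d
      d≢0 = ℚP.pos⇒nonZero d {{ℚ.positive 0<d}}
    ε : ℚ
    ε = m ℚ.* ℚ.1/ d
    0<ε : 0ℚ ℚ.< ε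
    0<ε = ℚP.positive⁻¹ ε {{ℚP.pos*pos⇒pos m {{ℚ.positive 0<m}} (ℚ.1/ d) {{ℚP.1/pos⇒pos d {{ℚ.positive 0<d}}}}}}
    instance
      ε≥0 : ℚ.NonNegative ε
      ε≥0 = ℚ.nonNegative (ℚP.<⇒≤ 0<ε)
    εY≤m : ε ℚ.* Y ℚ.≤ m
    εY≤m = ℚP.≤-trans
      (ℚP.*-monoˡ-≤-nonNeg ε (subst (ℚ._≤ d) (ℚP.+-identityˡ Y) (ℚP.+-monoˡ-≤ Y (ℚP.<⇒≤ (ℚP.positive⁻¹ 1ℚ)))))
      (ℚP.≤-reflexive (trans (ℚP.*-assoc m (ℚ.1/ d) d) (trans (cong (m ℚ.*_) (ℚP.*-inverseˡ d)) (ℚP.*-identityʳ m))))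
    Σ≡0 : totalSum (λ i → h i ℚ.+ ε ℚ.* (h i ℚ.- y i)) ≡ 0ℚ
    Σ≡0 = trans (pairing-perturb full h y ε)
            (trans (cong₂ (λ p q → p ℚ.+ ε ℚ.* (p ℚ.- q)) Σh≡0 (inDualCone-sum {r = r} y∈))
                   (solve 1 (λ e → con 0ℚ :+ e :* (con 0ℚ :- con 0ℚ) := con 0ℚ) refl ε))
    regroup : ∀ a b → a ℚ.+ ε ℚ.* (a ℚ.- b) ≡ (a ℚ.- ε ℚ.* b) ℚ.+ ε ℚ.* a
    regroup a b = solve 3 (λ a b e → a :+ e :* (a :- b) := (a :- e :* b) :+ e :* a) refl a b ε
    nonneg : ∀ {S} → upClosed r S ≡ true → twoLump S ≡ true →
      0ℚ ℚ.≤ pairingST S (λ i → h i ℚ.+ ε ℚ.* (h i ℚ.- y i))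
    nonneg {S} upS tlS = subst (0ℚ ℚ.≤_) (sym (trans (pairing-perturb S h y ε) (regroup (pairingST S h) (pairingST S y))))
      (ℚP.+-mono-≤ (ℚP.≤-trans (ℚP.≤-reflexive (sym (ℚP.+-inverseʳ (ε ℚ.* pairingST S y)))) (ℚP.+-monoˡ-≤ _ εyS≤hS))
                   (ℚP.≤-trans (ℚP.≤-reflexive (sym (ℚP.*-zeroʳ ε))) (ℚP.*-monoˡ-≤-nonNeg ε 0≤hS)))
      where
      0≤hS : 0ℚ ℚ.≤ pairingST S h
      0≤hS = ℚP.≤-trans (ℚP.<⇒≤ 0<m) (m≤ upS tlS)
      εyS≤hS : ε ℚ.* pairingST S y ℚ.≤ pairingST S h
      εyS≤hS = ℚP.≤-trans (ℚP.*-monoˡ-≤-nonNeg ε (pairing-≤-∑∣∣ S y)) (ℚP.≤-trans εY≤m (m≤ upS tlS))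

  positive-relint : ∀ {h} → totalSum h ≡ 0ℚ →
    (∀ {S} → upClosed r S ≡ true → twoLump S ≡ true → 0ℚ ℚ.< pairingST S h) → RelIntDualCone r h
  positive-relint {h} Σh≡0 pos =
    inDualCone-intro {r = r} Σh≡0 (λ upS tlS → ℚP.<⇒≤ (pos upS tlS)) , λ y → prolong 0<m Σh≡0 m≤
    where
    isFacet : Subset n → Bool
    isFacet S = upClosed r S ∧ twoLump S
    facets : List (Subset n)
    facets = filter (λ S → isFacet S Bool.≟ true) (allSubsets n)
    m : ℚ
    m = min 1ℚ (map (λ S → pairingST S h) facets)
    0<m : 0ℚ ℚ.< m
    0<m = argmin-all (λ q → q) {P = 0ℚ ℚ.<_} (ℚP.positive⁻¹ 1ℚ)
      (AllP.map⁺ (All.map (λ c → pos (∧-elimˡ c) (∧-elimʳ {upClosed r _} c))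
                          (all-filter (λ S → isFacet S Bool.≟ true) (allSubsets n))))
    m≤ : ∀ {S} → upClosed r S ≡ true → twoLump S ≡ true → m ℚ.≤ pairingST S h
    m≤ {S} upS tlS with allSubsets-complete S
    ... | S′ , S′∈ , S′≐S = subst (m ℚ.≤_) (pairing-cong h S′≐S)
      (All.lookup (f[argmin]≤f[xs] {f = λ q → q} 1ℚ (map (λ S → pairingST S h) facets))
        (∈-map⁺ (λ S → pairingST S h) (∈-filter⁺ (λ S → isFacet S Bool.≟ true) S′∈
          (∧-intro (trans (upClosed-cong r S′≐S) upS) (trans (twoLump-cong S′≐S) tlS)))))

-- Compositions

switch-point : ∀ (P : ℕ → Bool) l → P 0 ≡ false → P l ≡ true → ∃[ m ] (m < l × P (suc m) ≡ true × P m ≡ false)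
switch-point P zero P0 Pl = ⊥-elim (false≢true (trans (sym P0) Pl))
switch-point P (suc l) P0 Pl with P l in Pl′
... | false = l , ℕP.≤-refl , Pl , Pl′
... | true with switch-point P l P0 Pl′
...   | m , m<l , Pm+1 , Pm = m , ℕP.m≤n⇒m≤1+n m<l , Pm+1 , Pm

module Lumps {n : ℕ} (F : Composition n) where

  L : Fin n → ℕ
  L i = toℕ (lump F i)

  L< : ∀ i → L i < l F
  L< i = FinP.toℕ<n (lump F i)

  lump-surj : ∀ {k} → k < l F → ∃[ i ] L i ≡ k
  lump-surj k<l with surj F (Fin.fromℕ< k<l)
  ... | i , e = i , trans (cong toℕ e) (FinP.toℕ-fromℕ< k<l)

  opaque
    firstLumps : ℕ → Subset n
    firstLumps k i = L i ℕ.<ᵇ k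

    firstLumps-intro : ∀ {k i} → L i < k → firstLumps k i ≡ true
    firstLumps-intro = <ᵇ-complete

    firstLumps-elim : ∀ {k i} → firstLumps k i ≡ true → L i < k
    firstLumps-elim = <ᵇ-sound

    firstLumps-false : ∀ {k i} → k ≤ L i → firstLumps k i ≡ false
    firstLumps-false k≤Li = <ᵇ-false (ℕP.≤⇒≯ k≤Li)

  firstLumps-false-elim : ∀ {k i} → firstLumps k i ≡ false → k ≤ L i
  firstLumps-false-elim e = ℕP.≮⇒≥ λ Li<k → false≢true (trans (sym e) (firstLumps-intro Li<k))

  lastLumps : ℕ → Subset n
  lastLumps k = ∁ (firstLumps k)

  lastLumps-intro : ∀ {k i} → k ≤ L i → lastLumps k i ≡ true
  lastLumps-intro k≤Li = cong not (firstLumps-false k≤Li)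

  lastLumps-elim : ∀ {k i} → lastLumps k i ≡ true → k ≤ L i
  lastLumps-elim e = firstLumps-false-elim (not-injective e)

  -- ν k = Σ_{k ≤ j < l} 1_{firstLumps j} is where the chain firstLumps (l - 1) ⊋ ⋯ ⊋ firstLumps k has got to.
  ν : ℕ → Fin n → ℕ
  ν k i = l F ℕ.∸ (suc (L i) ℕ.⊔ k)

  ν-low : ∀ {k} i → suc (L i) ≤ k → ν k i ≡ l F ℕ.∸ k
  ν-low i le = cong (l F ℕ.∸_) (ℕP.m≤n⇒m⊔n≡n le)

  ν-high : ∀ {k} i → k ≤ suc (L i) → ν k i ≡ l F ℕ.∸ suc (L i)
  ν-high i le = cong (l F ℕ.∸_) (ℕP.m≥n⇒m⊔n≡m le)

  ν-step : ∀ {k} i → k < l F → ν k i ≡ ν (suc k) i ℕ.+ bit (firstLumps k i)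
  ν-step {k} i k<l with ℕP.<-cmp (L i) k
  ... | tri< Li<k _ _ rewrite firstLumps-intro Li<k | ν-low i Li<k | ν-low {suc k} i (ℕP.m≤n⇒m≤1+n Li<k) =
    trans (ℕP.+-∸-assoc 1 k<l) (ℕP.+-comm 1 _)
  ... | tri≈ _ refl _ rewrite firstLumps-false {L i} {i} ℕP.≤-refl | ν-high {L i} i (ℕP.n≤1+n _)
                            | ν-low {suc (L i)} i ℕP.≤-refl =
    sym (ℕP.+-identityʳ _)
  ... | tri> _ _ k<Li rewrite firstLumps-false {k} {i} (ℕP.<⇒≤ k<Li) | ν-high {k} i (ℕP.m≤n⇒m≤1+n (ℕP.<⇒≤ k<Li))
                            | ν-high {suc k} i (s≤s (ℕP.<⇒≤ k<Li)) =
    sym (ℕP.+-identityʳ _)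

  Induced : (Fin n → ℕ) → Set
  Induced μ = InducedIs (toℚ μ) F

  induced-elim : ∀ {μ} → Induced μ → ∀ {i j} → μ j ≤ μ i → L i ≤ L j
  induced-elim ind {i} {j} le = ≤ᵇ-sound (Equivalence.to (ind i j) (fromℕ-mono-≤ le))

  induced-elim′ : ∀ {μ} → Induced μ → ∀ {i j} → L i ≤ L j → μ j ≤ μ i
  induced-elim′ ind {i} {j} le = fromℕ-cancel-≤ (Equivalence.from (ind i j) (≤ᵇ-complete le))

  induced-intro : ∀ {μ} → (∀ {i j} → μ j ≤ μ i → L i ≤ L j) → (∀ {i j} → L i ≤ L j → μ j ≤ μ i) → Induced μ
  induced-intro f g i j = mk⇔ (λ le → ≤ᵇ-complete (f (fromℕ-cancel-≤ le))) (λ e → fromℕ-mono-≤ (g (≤ᵇ-sound e)))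

  induced-cong : ∀ {μ μ′} → (∀ i → μ i ≡ μ′ i) → Induced μ → Induced μ′
  induced-cong e ind = induced-intro
    (λ {i} {j} le → induced-elim ind (subst₂ _≤_ (sym (e j)) (sym (e i)) le))
    (λ {i} {j} le → subst₂ _≤_ (e j) (e i) (induced-elim′ ind le))

  ν1-induced : Induced (ν 1 +ᵛ 0ᵛ)
  ν1-induced = induced-intro
    (λ {i} {j} le → ℕP.≤-pred (ℕP.∸-cancelʳ-≤ (L< i) (subst₂ _≤_ (at j) (at i) le)))
    (λ {i} {j} le → subst₂ _≤_ (sym (at j)) (sym (at i)) (ℕP.∸-monoʳ-≤ (l F) (s≤s le)))
    where
    at : ∀ i → ν 1 i ℕ.+ 0 ≡ l F ℕ.∸ suc (L i)
    at i = trans (ℕP.+-identityʳ _) (ν-high i (s≤s z≤n))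

  -- For k ≥ 2 the point ν k gives the first two lumps the same value.
  ν2+-not-induced : ∀ k → 2 ℕ.+ k ≤ l F → ¬ Induced (ν (2 ℕ.+ k) +ᵛ 0ᵛ)
  ν2+-not-induced k k+2≤l ind
    with lump-surj (ℕP.<-≤-trans (s≤s z≤n) k+2≤l) | lump-surj (ℕP.<-≤-trans (s≤s (s≤s z≤n)) k+2≤l)
  ... | i₀ , L0 | i₁ , L1 = 1≰0 (subst₂ _≤_ L1 L0 (induced-elim ind (ℕP.≤-reflexive same)))
    where
    1≰0 : ¬ 1 ≤ 0
    1≰0 ()
    same : ν (2 ℕ.+ k) i₀ ℕ.+ 0 ≡ ν (2 ℕ.+ k) i₁ ℕ.+ 0
    same = cong (ℕ._+ 0) (trans (ν-low i₀ (subst (λ x → suc x ≤ 2 ℕ.+ k) (sym L0) (s≤s z≤n)))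
                                (sym (ν-low i₁ (subst (λ x → suc x ≤ 2 ℕ.+ k) (sym L1) (s≤s (s≤s z≤n))))))

  off-chain-not-induced : ∀ k {B S μ} → B ≐ firstLumps (suc k) → suc k ≤ l F → S ⊂ᵇ B ≡ true → ¬ S ≐ firstLumps k →
    SupportedIn μ S → ¬ Induced (ν (suc k) +ᵛ raise S μ)
  off-chain-not-induced k {B} {S} {μ} B≐ k<l S⊂B S≭ μ∈S ind
    with FinP.¬∀⟶∃¬ n (λ i → S i ≡ firstLumps k i) (λ i → S i Bool.≟ firstLumps k i) S≭
  ... | i , Si≢ with S i in Si | firstLumps k i in Fi
  ...   | true | true = Si≢ refl
  ...   | false | false = Si≢ refl
  ...   | true | false with ⊂ᵇ-witness S⊂B
  ...     | i′ , Bi′ , Si′ = too-high (induced-elim′ ind (ℕP.≤-trans (ℕP.≤-pred Li′<k+1) (firstLumps-false-elim Fi)))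
    where
    Li<k+1 : L i < suc k
    Li<k+1 = firstLumps-elim (trans (sym (B≐ i)) (⊆ᵇ-elim (∧-elimˡ S⊂B) i Si))
    Li′<k+1 : L i′ < suc k
    Li′<k+1 = firstLumps-elim (trans (sym (B≐ i′)) Bi′)
    too-high : ¬ ν (suc k) i ℕ.+ raise S μ i ≤ ν (suc k) i′ ℕ.+ raise S μ i′
    too-high le rewrite Si | Si′ | μ∈S i′ Si′ | ν-low i Li<k+1 | ν-low i′ Li′<k+1
      with ℕP.+-cancelˡ-≤ (l F ℕ.∸ suc k) _ _ le
    ... | ()
  off-chain-not-induced k {B} {S} {μ} B≐ k<l S⊂B S≭ μ∈S ind | i , Si≢ | false | true with lump-surj k<l
  ...     | j , Lj = ℕP.<-irrefl refl (ℕP.<-≤-trans Li<k (subst (_≤ L i) Lj (induced-elim ind low)))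
    where
    Li<k : L i < k
    Li<k = firstLumps-elim Fi
    low : ν (suc k) i ℕ.+ raise S μ i ≤ ν (suc k) j ℕ.+ raise S μ j
    low rewrite Si | μ∈S i Si | ν-low i (ℕP.m≤n⇒m≤1+n Li<k) | ν-low j (s≤s (ℕP.≤-reflexive Lj))
              | ℕP.+-identityʳ (l F ℕ.∸ suc k) =
      ℕP.m≤m+n _ _

  barRel : ∀ a b → compRel (bar F) a b ≡ (L b ℕ.≤ᵇ L a)
  barRel a b = trans (cong₂ ℕ._≤ᵇ_ (FinP.opposite-prop (lump F a)) (FinP.opposite-prop (lump F b)))
    (≡true-ext (λ e → ≤ᵇ-complete (ℕP.≤-pred (ℕP.∸-cancelʳ-≤ (L< b) (≤ᵇ-sound e))))
               (λ e → ≤ᵇ-complete (ℕP.∸-monoʳ-≤ (l F) (s≤s (≤ᵇ-sound e)))))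

  barRel-intro : ∀ {a b} → L b ≤ L a → compRel (bar F) a b ≡ true
  barRel-intro {a} {b} Lb≤La = trans (barRel a b) (≤ᵇ-complete Lb≤La)

  barRel-elim : ∀ {a b} → compRel (bar F) a b ≡ true → L b ≤ L a
  barRel-elim {a} {b} e = ≤ᵇ-sound (trans (sym (barRel a b)) e)

  lastLumps-upClosed : ∀ j → upClosed (compRel (bar F)) (lastLumps j) ≡ true
  lastLumps-upClosed j =
    upClosed-intro {r = compRel (bar F)} λ Ui ≥i → lastLumps-intro (ℕP.≤-trans (lastLumps-elim Ui) (barRel-elim ≥i))

  lastLumps-twoLump : ∀ {j} → 1 ≤ j → j < l F → twoLump (lastLumps j) ≡ true
  lastLumps-twoLump {j} 1≤j j<l with lump-surj j<l | lump-surj (ℕP.<-≤-trans 1≤j (ℕP.<⇒≤ j<l))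
  ... | a , La | b , Lb = twoLump-intro a b (lastLumps-intro (ℕP.≤-reflexive (sym La)))
                                            (cong not (firstLumps-intro (subst (_< j) (sym Lb) 1≤j)))

  upset-lastLumps : ∀ {S} → upClosed (compRel (bar F)) S ≡ true → twoLump S ≡ true →
    ∃[ m ] (1 ≤ m × m < l F × S ≐ lastLumps m)
  upset-lastLumps {S} upS tlS with switch-point (λ t → lastLumps t ⊆ᵇ S) (l F) P0 Pl
    where
    P0 : lastLumps 0 ⊆ᵇ S ≡ false
    P0 with any-witness (not ∘ S) (allFin n) (∧-elimʳ {any S (allFin n)} tlS)
    ... | i , _ , Si = ¬-not λ U⊆S → false≢true (trans (sym (not-injective Si)) (⊆ᵇ-elim U⊆S i (lastLumps-intro z≤n)))
    Pl : lastLumps (l F) ⊆ᵇ S ≡ true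
    Pl = ⊆ᵇ-intro λ i Ui → ⊥-elim (ℕP.<⇒≱ (L< i) (lastLumps-elim Ui))
  ... | m , m<l , Um+1⊆S , Um⊈S = suc m , s≤s z≤n , m+1<l , S≐
    where
    S≐ : S ≐ lastLumps (suc m)
    S≐ i = ≡true-ext S→U (⊆ᵇ-elim Um+1⊆S i)
      where
      S→U : S i ≡ true → lastLumps (suc m) i ≡ true
      S→U Si with ⊆ᵇ-false-witness Um⊈S
      ... | i₁ , Ui₁ , Si₁ = lastLumps-intro (ℕP.≮⇒≥ λ Li<m+1 → false≢true (trans (sym Si₁)
              (upClosed-elim {r = compRel (bar F)} {S = S} upS Si
                 (barRel-intro (ℕP.≤-trans (ℕP.≤-pred Li<m+1) (lastLumps-elim Ui₁))))))
    m+1<l : suc m < l F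
    m+1<l with ℕP.m≤n⇒m<n∨m≡n m<l
    ... | inj₁ lt = lt
    ... | inj₂ m+1≡l with any-witness S (allFin n) (∧-elimˡ tlS)
    ...   | i , _ , Si = ⊥-elim (ℕP.<⇒≱ (L< i) (subst (_≤ L i) m+1≡l (lastLumps-elim (trans (sym (S≐ i)) Si))))

  module _ (h : Fin n → ℚ) (h0 : totalSum h ≡ 0ℚ) where

    negativeFlags : ℕ → Bool
    negativeFlags zero = true
    negativeFlags (suc k) = negative h (firstLumps (suc k)) ∧ negativeFlags k

    negativeFlags-elim : ∀ {k j} → negativeFlags k ≡ true → 1 ≤ j → j ≤ k → negative h (firstLumps j) ≡ true
    negativeFlags-elim {zero} _ 1≤j j≤0 = ⊥-elim (ℕP.<-irrefl refl (ℕP.<-≤-trans 1≤j j≤0))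
    negativeFlags-elim {suc k} flags 1≤j j≤k with ℕP.m≤n⇒m<n∨m≡n j≤k
    ... | inj₁ j<k+1 = negativeFlags-elim (∧-elimʳ {negative h (firstLumps (suc k))} flags) 1≤j (ℕP.≤-pred j<k+1)
    ... | inj₂ refl = ∧-elimˡ flags

    negativeFlags-intro : ∀ {k} → (∀ {j} → 1 ≤ j → j ≤ k → negative h (firstLumps j) ≡ true) → negativeFlags k ≡ true
    negativeFlags-intro {zero} f = refl
    negativeFlags-intro {suc k} f =
      ∧-intro (f (s≤s z≤n) ℕP.≤-refl) (negativeFlags-intro (λ 1≤j j≤k → f 1≤j (ℕP.m≤n⇒m≤1+n j≤k)))

    pairing-lastLumps : ∀ j → pairingST (lastLumps j) h ≡ ℚ.- pairingST (firstLumps j) h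
    pairing-lastLumps j = ≡-neg (trans (pairing-∁ (firstLumps j) h) h0)
      where
      ≡-neg : ∀ {a b} → a ℚ.+ b ≡ 0ℚ → a ≡ ℚ.- b
      ≡-neg {a} {b} a+b≡0 =
        trans (solve 2 (λ a b → a := (a :+ b) :- b) refl a b) (trans (cong (ℚ._- b) a+b≡0) (ℚP.+-identityˡ (ℚ.- b)))
        where open +-*-Solver

    relint⇒negativeFlags : ∀ {k} → l F ≡ suc k → RelIntDualCone (compRel (bar F)) h → negativeFlags k ≡ true
    relint⇒negativeFlags {k} l≡ relint =
      negativeFlags-intro λ {j} 1≤j j≤k → firstLumps-negative 1≤j (subst (j <_) (sym l≡) (s≤s j≤k))
      where
      -- Witnessed by the cone point y = δ a − δ b, with a in lump j and b in lump j - 1.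
      firstLumps-negative : ∀ {j} → 1 ≤ j → j < l F → negative h (firstLumps j) ≡ true
      firstLumps-negative {suc j′} 1≤j j<l with lump-surj j<l | lump-surj (ℕP.<-trans (ℕP.n<1+n j′) j<l)
      ... | a , La | b , Lb = negative-complete h (neg-positive⇒negative (subst (0ℚ ℚ.<_) (pairing-lastLumps (suc j′))
            (relint-positive {r = compRel (bar F)} relint y∈ (lastLumps-upClosed (suc j′)) (lastLumps-twoLump 1≤j j<l) 0<yU)))
        where
        y : Fin n → ℚ
        y i = δ a i ℚ.- δ b i
        yS : ∀ S → pairingST S y ≡ bitℚ (S a) ℚ.- bitℚ (S b)
        yS S = trans (pairing-- S (δ a) (δ b)) (cong₂ ℚ._-_ (pairing-δ S a) (pairing-δ S b))
        a≥b : compRel (bar F) a b ≡ true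
        a≥b = barRel-intro (subst₂ _≤_ (sym Lb) (sym La) (ℕP.n≤1+n j′))
        nonneg : ∀ {S} x z → S a ≡ x → S b ≡ z → upClosed (compRel (bar F)) S ≡ true → 0ℚ ℚ.≤ bitℚ x ℚ.- bitℚ z
        nonneg true true _ _ _ = ℚP.≤-refl
        nonneg true false _ _ _ = ℚP.<⇒≤ (ℚP.positive⁻¹ 1ℚ)
        nonneg false false _ _ _ = ℚP.≤-refl
        nonneg {S} false true Sa Sb upS =
          ⊥-elim (false≢true (trans (sym Sa) (upClosed-elim {r = compRel (bar F)} {S = S} upS Sb a≥b)))
        y∈ : inDualCone (compRel (bar F)) y ≡ true
        y∈ = inDualCone-intro {r = compRel (bar F)} (trans (yS full) (ℚP.+-inverseʳ 1ℚ)) λ {S} upS _ →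
          subst (0ℚ ℚ.≤_) (sym (yS S)) (nonneg (S a) (S b) refl refl upS)
        0<yU : 0ℚ ℚ.< pairingST (lastLumps (suc j′)) y
        0<yU rewrite yS (lastLumps (suc j′)) | lastLumps-intro {suc j′} {a} (ℕP.≤-reflexive (sym La))
                   | firstLumps-intro {suc j′} {b} (subst (_< suc j′) (sym Lb) (ℕP.n<1+n j′)) = ℚP.positive⁻¹ 1ℚ

    negativeFlags⇒relint : ∀ {k} → l F ≡ suc k → negativeFlags k ≡ true → RelIntDualCone (compRel (bar F)) h
    negativeFlags⇒relint l≡ flags = positive-relint {r = compRel (bar F)} h0 positive
      where
      positive : ∀ {S} → upClosed (compRel (bar F)) S ≡ true → twoLump S ≡ true → 0ℚ ℚ.< pairingST S h
      positive upS tlS with upset-lastLumps upS tlS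
      ... | m , 1≤m , m<l , S≐ = subst (0ℚ ℚ.<_) (sym (trans (pairing-cong h S≐) (pairing-lastLumps m)))
            (ℚP.neg-antimono-< (negative-sound h (negativeFlags-elim flags 1≤m (ℕP.≤-pred (subst (m <_) l≡ m<l)))))

-- Braid cones of arbitrary relations

module _ {n : ℕ} where

  -- The reflexive-transitive closure of r: i ≥ j iff every r-upset containing j contains i.
  closureRel : BRel n → BRel n
  closureRel r i j = all (λ S → not (upClosed r S ∧ S j) ∨ S i) (allSubsets n)

  closureRel-intro : ∀ {r i j} → (∀ {S} → upClosed r S ≡ true → S j ≡ true → S i ≡ true) → closureRel r i j ≡ true
  closureRel-intro {r} {i} {j} f =
    all-intro (λ S → not (upClosed r S ∧ S j) ∨ S i) (allSubsets n) λ {S} _ →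
      →ᵇ-intro {upClosed r S ∧ S j} λ c → f (∧-elimˡ c) (∧-elimʳ {upClosed r S} c)

  closureRel-elim : ∀ {r i j S} → closureRel r i j ≡ true → upClosed r S ≡ true → S j ≡ true → S i ≡ true
  closureRel-elim {r} {i} {j} {S} i≥j upS Sj with allSubsets-complete S
  ... | S′ , S′∈ , S′≐S = trans (sym (S′≐S i))
    (→ᵇ-elim (all-elim (λ S → not (upClosed r S ∧ S j) ∨ S i) i≥j S′∈)
             (∧-intro (trans (upClosed-cong r S′≐S) upS) (trans (S′≐S j) Sj)))

  closure : BRel n → Preposet n
  closure r = record
    { rel = closureRel r
    ; reflex = λ i → closureRel-intro (λ _ Si → Si)
    ; trans' = λ i j k i≥j j≥k → closureRel-intro λ upS Sk → closureRel-elim i≥j upS (closureRel-elim j≥k upS Sk)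
    }

  inBraidCone-closure : ∀ r x → inBraidCone (closureRel r) x ≡ inBraidCone r x
  inBraidCone-closure r x = ≡true-ext
    (λ x∈ → inBraidCone-intro {r = r} {x = x} λ rij →
      inBraidCone-elim {r = closureRel r} {x = x} x∈ (closureRel-intro λ upS Sj → upClosed-elim {r = r} upS Sj rij))
    (λ x∈ → inBraidCone-intro {r = closureRel r} {x = x} λ {i} {j} i≥j →
      closureRel-elim {S = λ k → x j ℚ.≤ᵇ x k} i≥j (at-least-upClosed x∈ j) (ℚ≤ᵇ-complete {x j} ℚP.≤-refl))
    where
    at-least-upClosed : inBraidCone r x ≡ true → ∀ j → upClosed r (λ k → x j ℚ.≤ᵇ x k) ≡ true
    at-least-upClosed x∈ j = upClosed-intro {r = r} λ {a} {b} xj≤xa rba →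
      ℚ≤ᵇ-complete {x j} {x b}
        (ℚP.≤-trans (ℚ≤ᵇ-sound {x j} {x a} xj≤xa) (ℚ≤ᵇ-sound {x a} {x b} (inBraidCone-elim {r = r} {x = x} x∈ rba)))

  addPair : BRel n → Fin n → Fin n → BRel n
  addPair r a b i j = r i j ∨ (⌊ i Fin.≟ a ⌋ ∧ ⌊ j Fin.≟ b ⌋)

  inBraidCone-addPair : ∀ r a b x → inBraidCone (addPair r a b) x ≡ inBraidCone r x ∧ (x b ℚ.≤ᵇ x a)
  inBraidCone-addPair r a b x = ≡true-ext
    (λ x∈ → ∧-intro
      (inBraidCone-intro {r = r} {x = x} λ rij → inBraidCone-elim {r = addPair r a b} {x = x} x∈ (cong (_∨ _) rij))
      (inBraidCone-elim {r = addPair r a b} {x = x} x∈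
        (trans (cong (r a b ∨_) (cong₂ _∧_ (≟-diag a) (≟-diag b))) (∨-zeroʳ (r a b)))))
    (λ x∈ → inBraidCone-intro {r = addPair r a b} {x = x} λ {i} {j} → le x∈ i j (r i j) refl)
    where
    ≟-diag : ∀ (c : Fin n) → ⌊ c Fin.≟ c ⌋ ≡ true
    ≟-diag c = Equivalence.to T-≡ (fromWitness refl)
    le : inBraidCone r x ∧ (x b ℚ.≤ᵇ x a) ≡ true →
      ∀ i j v → r i j ≡ v → addPair r a b i j ≡ true → (x j ℚ.≤ᵇ x i) ≡ true
    le x∈ i j true rij _ = inBraidCone-elim {r = r} {x = x} (∧-elimˡ x∈) rij
    le x∈ i j false rij e with i Fin.≟ a | j Fin.≟ b | trans (sym (cong (_∨ _) rij)) e
    ... | yes refl | yes refl | _ = ∧-elimʳ {inBraidCone r x} x∈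

  agrees : Composition n → (Fin n → ℚ) → Fin n × Fin n → Bool
  agrees F x ab =
    if compRel F (proj₁ ab) (proj₂ ab) then x (proj₂ ab) ℚ.≤ᵇ x (proj₁ ab) else not (x (proj₂ ab) ℚ.≤ᵇ x (proj₁ ab))

  all-agrees⇔induced : ∀ F x → all (agrees F x) (pairs n) ≡ true ⇔ InducedIs x F
  all-agrees⇔induced F x = mk⇔
    (λ ag i j → let e = agrees-elim i j (all-elim (agrees F x) ag (∈-pairs i j)) in
       mk⇔ (λ le → trans (sym e) (ℚ≤ᵇ-complete le)) (λ c → ℚ≤ᵇ-sound (trans e c)))
    (λ ind → all-intro (agrees F x) (pairs n) λ { {i , j} _ →
      agrees-intro i j (≡true-ext (Equivalence.to (ind i j) ∘ ℚ≤ᵇ-sound) (ℚ≤ᵇ-complete ∘ Equivalence.from (ind i j))) })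
    where
    agrees-elim : ∀ a b → agrees F x (a , b) ≡ true → (x b ℚ.≤ᵇ x a) ≡ compRel F a b
    agrees-elim a b e with compRel F a b | x b ℚ.≤ᵇ x a
    ... | true | true = refl
    ... | false | false = refl
    ... | true | false = ⊥-elim (false≢true e)
    ... | false | true = ⊥-elim (false≢true e)
    agrees-intro : ∀ a b → (x b ℚ.≤ᵇ x a) ≡ compRel F a b → agrees F x (a , b) ≡ true
    agrees-intro a b e with compRel F a b | x b ℚ.≤ᵇ x a
    ... | true | true = refl
    ... | false | false = refl
    ... | true | false = ⊥-elim (false≢true e)
    ... | false | true = ⊥-elim (false≢true (sym e))

-- Chain sums

module _ {c ℓ} (R : CommutativeRing c ℓ) where

  open CommutativeRing R hiding (zero) renaming (refl to ≈-refl; sym to ≈-sym; trans to ≈-trans; reflexive to ≈-reflexive)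
  open Over R
  open import Relation.Binary.Reasoning.Setoid setoid
  open import Algebra.Properties.Ring ring using (-‿distribˡ-*; -‿distribʳ-*; -‿+-comm; -0#≈0#)
  open NR (fromCommutativeRing R (λ _ → nothing)) using (solve; _⊜_; _⊕_; _⊗_)

  +-‿-interchange : ∀ a b c d → (a + b) + - (c + d) ≈ (a + - c) + (b + - d)
  +-‿-interchange a b c d = ≈-trans (+-congˡ (≈-sym (-‿+-comm c d)))
    (solve 4 (λ a b c d → ((a ⊕ b) ⊕ (c ⊕ d)) ⊜ ((a ⊕ c) ⊕ (b ⊕ d))) ≈-refl a b (- c) (- d))

  x-0#≈x : ∀ x → x + - 0# ≈ x
  x-0#≈x x = ≈-trans (+-congˡ -0#≈0#) (+-identityʳ x)

  *-distribˡ-‿ : ∀ a x y → a * (x + - y) ≈ a * x + - (a * y)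
  *-distribˡ-‿ a x y = ≈-trans (distribˡ a x (- y)) (+-congˡ (≈-sym (-‿distribʳ-* a y)))

  ∑ : ∀ {a} {A : Set a} → List A → (A → Carrier) → Carrier
  ∑ [] φ = 0#
  ∑ (x ∷ xs) φ = φ x + ∑ xs φ

  syntax ∑ xs (λ x → e) = ∑[ x ∈ xs ] e

  module _ {a} {A : Set a} where

    ∑-cong : ∀ (xs : List A) {φ ψ} → (∀ x → φ x ≈ ψ x) → ∑ xs φ ≈ ∑ xs ψ
    ∑-cong [] e = ≈-refl
    ∑-cong (x ∷ xs) e = +-cong (e x) (∑-cong xs e)

    ∑-+ : ∀ (xs : List A) φ ψ → ∑[ x ∈ xs ] (φ x + ψ x) ≈ ∑ xs φ + ∑ xs ψ
    ∑-+ [] φ ψ = ≈-sym (+-identityʳ 0#)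
    ∑-+ (x ∷ xs) φ ψ = ≈-trans (+-congˡ (∑-+ xs φ ψ))
      (solve 4 (λ a b c d → ((a ⊕ b) ⊕ (c ⊕ d)) ⊜ ((a ⊕ c) ⊕ (b ⊕ d))) ≈-refl (φ x) (ψ x) (∑ xs φ) (∑ xs ψ))

    ∑-*ˡ : ∀ (xs : List A) a φ → ∑[ x ∈ xs ] (a * φ x) ≈ a * ∑ xs φ
    ∑-*ˡ [] a φ = ≈-sym (zeroʳ a)
    ∑-*ˡ (x ∷ xs) a φ = ≈-trans (+-congˡ (∑-*ˡ xs a φ)) (≈-sym (distribˡ a (φ x) (∑ xs φ)))

    ∑-zero : ∀ (xs : List A) {φ} → (∀ x → φ x ≈ 0#) → ∑ xs φ ≈ 0#
    ∑-zero [] e = ≈-refl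
    ∑-zero (x ∷ xs) e = ≈-trans (+-cong (e x) (∑-zero xs e)) (+-identityʳ 0#)

    ∑-++ : ∀ (xs ys : List A) φ → ∑ (xs ++ ys) φ ≈ ∑ xs φ + ∑ ys φ
    ∑-++ [] ys φ = ≈-sym (+-identityˡ _)
    ∑-++ (x ∷ xs) ys φ = ≈-trans (+-congˡ (∑-++ xs ys φ)) (≈-sym (+-assoc _ _ _))

  ∑-concatMap : ∀ {A B : Set} (f : A → List B) (xs : List A) φ → ∑ (concatMap f xs) φ ≈ ∑[ x ∈ xs ] ∑ (f x) φ
  ∑-concatMap f [] φ = ≈-refl
  ∑-concatMap f (x ∷ xs) φ = ≈-trans (∑-++ (f x) (concatMap f xs) φ) (+-congˡ (∑-concatMap f xs φ))

  ∑-allSubsets-single : ∀ {n} (φ : Subset n → Carrier) T {X} →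
    (∀ S → S ≐ T → φ S ≈ X) → (∀ S → ¬ S ≐ T → φ S ≈ 0#) → ∑ (allSubsets n) φ ≈ X
  ∑-allSubsets-single {zero} φ T at off = ≈-trans (+-identityʳ _) (at _ (λ ()))
  ∑-allSubsets-single {suc n} φ T {X} at off =
    ≈-trans (∑-concatMap (λ S → consS false S ∷ consS true S ∷ []) (allSubsets n) φ)
            (∑-allSubsets-single pairSum (T ∘ Fin.suc) at′ off′)
    where
    pairSum : Subset n → Carrier
    pairSum S = φ (consS false S) + (φ (consS true S) + 0#)
    tail≭ : ∀ {S} b → ¬ S ≐ T ∘ Fin.suc → ¬ consS b S ≐ T
    tail≭ b ne e = ne (e ∘ Fin.suc)
    head≭ : ∀ {S} b → b ≢ T Fin.zero → ¬ consS b S ≐ T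
    head≭ b b≢ e = b≢ (e Fin.zero)
    at′ : ∀ S → S ≐ T ∘ Fin.suc → pairSum S ≈ X
    at′ S e with T Fin.zero in T0
    ... | false = ≈-trans (+-cong (at _ S≐) (≈-trans (+-identityʳ _) (off _ (head≭ true true≢)))) (+-identityʳ X)
      where
      true≢ : true ≢ T Fin.zero
      true≢ t≡ = false≢true (trans (sym T0) (sym t≡))
      S≐ : consS false S ≐ T
      S≐ Fin.zero = sym T0
      S≐ (Fin.suc i) = e i
    ... | true = ≈-trans (+-cong (off _ (head≭ false false≢)) (≈-trans (+-identityʳ _) (at _ S≐))) (+-identityˡ X)
      where
      false≢ : false ≢ T Fin.zero
      false≢ f≡ = false≢true (trans f≡ T0)
      S≐ : consS true S ≐ T
      S≐ Fin.zero = sym T0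
      S≐ (Fin.suc i) = e i
    off′ : ∀ S → ¬ S ≐ T ∘ Fin.suc → pairSum S ≈ 0#
    off′ S ne = ≈-trans (+-cong (off _ (tail≭ false ne)) (≈-trans (+-identityʳ _) (off _ (tail≭ true ne)))) (+-identityʳ 0#)

  ind-∧ : ∀ a b → ind (a ∧ b) ≈ ind a * ind b
  ind-∧ true b = ≈-sym (*-identityˡ _)
  ind-∧ false b = ≈-sym (zeroˡ _)

  ind-true : ∀ {a} → a ≡ true → ind a ≈ 1#
  ind-true refl = ≈-refl

  ind-false : ∀ {a} → a ≡ false → ind a ≈ 0#
  ind-false refl = ≈-refl

  ind-false-* : ∀ {a} x → a ≡ false → ind a * x ≈ 0#
  ind-false-* x refl = zeroˡ x

  ind-*-cong : ∀ a {x y} → (a ≡ true → x ≈ y) → ind a * x ≈ ind a * y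
  ind-*-cong true x≈y = *-congˡ (x≈y refl)
  ind-*-cong false x≈y = ≈-trans (zeroˡ _) (≈-sym (zeroˡ _))

  ind-split-∧ʳ : ∀ a b c → ind (a ∧ b) ≈ ind (a ∧ (b ∧ c)) + ind (a ∧ (b ∧ not c))
  ind-split-∧ʳ false b c = ≈-sym (+-identityʳ 0#)
  ind-split-∧ʳ true false c = ≈-sym (+-identityʳ 0#)
  ind-split-∧ʳ true true true = ≈-sym (+-identityʳ 1#)
  ind-split-∧ʳ true true false = ≈-sym (+-identityˡ 1#)

  ind-split-∧ˡ : ∀ a p q → ind (a ∧ q) ≈ ind (a ∧ (p ∧ q)) + ind (a ∧ (not p ∧ q))
  ind-split-∧ˡ false p q = ≈-sym (+-identityʳ 0#)
  ind-split-∧ˡ true true q = ≈-sym (+-identityʳ _)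
  ind-split-∧ˡ true false q = ≈-sym (+-identityˡ _)

  ind-*-vanish : ∀ a {x} → (a ≡ true → x ≈ 0#) → ind a * x ≈ 0#
  ind-*-vanish a x≈0 = ≈-trans (ind-*-cong a x≈0) (zeroʳ _)

  braidCone≈ind : ∀ {n} (r : BRel n) x → braidCone r x ≈ ind (inBraidCone r x)
  braidCone≈ind {n} r x = foldr-step (λ _ _ _ → refl) (pairs n)
    where
    -- Stated for every step function agreeing with the anonymous one in braidCone.
    foldr-step : ∀ {step : Fin n × Fin n → Carrier → Carrier} →
      (∀ i j acc → step (i , j) acc ≡ (if not ⌊ i Fin.≟ j ⌋ ∧ r i j then halfspace i j x * acc else acc)) →
      ∀ ps → foldr step 1# ps ≈ ind (all (conePair r x) ps)
    foldr-step step≡ [] = ≈-refl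
    foldr-step {step} step≡ ((i , j) ∷ ps) rewrite step≡ i j (foldr step 1# ps) with i Fin.≟ j
    ... | yes refl = ≈-trans (foldr-step step≡ ps) (≈-reflexive (cong (λ b → ind (b ∧ all (conePair r x) ps)) (sym diagonal)))
      where
      diagonal : conePair r x (i , i) ≡ true
      diagonal = trans (cong (not (r i i) ∨_) (ℚ≤ᵇ-complete {x i} ℚP.≤-refl)) (∨-zeroʳ _)
    ... | no _ with r i j
    ...   | true = ≈-trans (*-congˡ (foldr-step step≡ ps)) (≈-sym (ind-∧ _ _))
    ...   | false = foldr-step step≡ ps

  module Chains {n : ℕ} (h : Fin n → ℚ) where

    -- Unfolding the recursion, chainSum k B g is the sum, over the chains B ⊋ S₁ ⊋ ⋯ ⊋ Sₘ (m ≤ k) of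
    -- h-negative sets, of (-1)ᵐ g (1_{S₁} + ⋯ + 1_{Sₘ}).
    chainSum : ℕ → Subset n → ((Fin n → ℕ) → Carrier) → Carrier
    chainSum zero B g = g 0ᵛ
    chainSum (suc k) B g = g 0ᵛ + - ∑[ S ∈ allSubsets n ] (ind (negative h S ∧ S ⊂ᵇ B) * chainSum k S (g ∘ raise S))

    chainSum-cong : ∀ k B {g g′} → (∀ μ → SupportedIn μ B → g μ ≈ g′ μ) → chainSum k B g ≈ chainSum k B g′
    chainSum-cong zero B e = e 0ᵛ (λ _ _ → refl)
    chainSum-cong (suc k) B e = +-cong (e 0ᵛ (λ _ _ → refl)) (-‿cong (∑-cong (allSubsets n) λ S →
      ind-*-cong (negative h S ∧ S ⊂ᵇ B) λ below → chainSum-cong k S λ μ μ∈S →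
        e (raise S μ) (raise-supportedIn (∧-elimˡ (∧-elimʳ {negative h S} below)) μ∈S)))

    chainSum-+ : ∀ k B g g′ → chainSum k B (λ μ → g μ + g′ μ) ≈ chainSum k B g + chainSum k B g′
    chainSum-+ zero B g g′ = ≈-refl
    chainSum-+ (suc k) B g g′ = begin
      (g 0ᵛ + g′ 0ᵛ) + - ∑[ S ∈ allSubsets n ] (I S * chainSum k S (λ μ → g (raise S μ) + g′ (raise S μ)))
        ≈⟨ +-congˡ (-‿cong (∑-cong (allSubsets n) λ S → ≈-trans (*-congˡ (chainSum-+ k S _ _)) (distribˡ _ _ _))) ⟩
      (g 0ᵛ + g′ 0ᵛ) + - ∑[ S ∈ allSubsets n ] (I S * X S + I S * Y S)
        ≈⟨ +-congˡ (-‿cong (∑-+ (allSubsets n) _ _)) ⟩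
      (g 0ᵛ + g′ 0ᵛ) + - (∑[ S ∈ allSubsets n ] (I S * X S) + ∑[ S ∈ allSubsets n ] (I S * Y S))
        ≈⟨ +-‿-interchange _ _ _ _ ⟩
      chainSum (suc k) B g + chainSum (suc k) B g′ ∎
      where
      I : Subset n → Carrier
      I S = ind (negative h S ∧ S ⊂ᵇ B)
      X Y : Subset n → Carrier
      X S = chainSum k S (g ∘ raise S)
      Y S = chainSum k S (g′ ∘ raise S)

    chainSum-*ˡ : ∀ k B a g → chainSum k B (λ μ → a * g μ) ≈ a * chainSum k B g
    chainSum-*ˡ zero B a g = ≈-refl
    chainSum-*ˡ (suc k) B a g = begin
      a * g 0ᵛ + - ∑[ S ∈ allSubsets n ] (I S * chainSum k S (λ μ → a * g (raise S μ)))
        ≈⟨ +-congˡ (-‿cong (∑-cong (allSubsets n) λ S → ≈-trans (*-congˡ (chainSum-*ˡ k S a _))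
                     (solve 3 (λ i a x → (i ⊗ (a ⊗ x)) ⊜ (a ⊗ (i ⊗ x))) ≈-refl (I S) a _))) ⟩
      a * g 0ᵛ + - ∑[ S ∈ allSubsets n ] (a * (I S * X S))
        ≈⟨ +-congˡ (-‿cong (∑-*ˡ (allSubsets n) a _)) ⟩
      a * g 0ᵛ + - (a * ∑[ S ∈ allSubsets n ] (I S * X S))
        ≈⟨ ≈-sym (*-distribˡ-‿ a _ _) ⟩
      a * chainSum (suc k) B g ∎
      where
      I X : Subset n → Carrier
      I S = ind (negative h S ∧ S ⊂ᵇ B)
      X S = chainSum k S (g ∘ raise S)

    chainSum-vanish : ∀ k B {g} → (∀ μ → SupportedIn μ B → g μ ≈ 0#) → chainSum k B g ≈ 0#
    chainSum-vanish k B {g} g≈0 = begin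
      chainSum k B g                  ≈⟨ chainSum-cong k B (λ μ μ∈B → ≈-trans (g≈0 μ μ∈B) (≈-sym (zeroˡ 0#))) ⟩
      chainSum k B (λ _ → 0# * 0#)    ≈⟨ chainSum-*ˡ k B 0# (λ _ → 0#) ⟩
      0# * chainSum k B (λ _ → 0#)    ≈⟨ zeroˡ _ ⟩
      0#                              ∎

    chainSum-evalHat : ∀ k B (cs : Combo n) → chainSum k B (λ μ → evalHat cs (toℚ μ))
      ≈ ∑[ c ∈ cs ] (proj₁ c * chainSum k B (λ μ → braidCone (rel (proj₂ c)) (toℚ μ)))
    chainSum-evalHat k B [] = chainSum-vanish k B (λ _ _ → ≈-refl)
    chainSum-evalHat k B ((a , p) ∷ cs) =
      ≈-trans (chainSum-+ k B _ _) (+-cong (chainSum-*ˡ k B a _) (chainSum-evalHat k B cs))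

    negativeUpset : BRel n → Subset n → Bool
    negativeUpset r S = negative h S ∧ upClosed r S

    negativeUpset-cong : ∀ {r S S′} → S ≐ S′ → negativeUpset r S ≡ negativeUpset r S′
    negativeUpset-cong {r} e = cong₂ _∧_ (negative-cong h e) (upClosed-cong r e)

    -- The signed number of chains B ⊋ S₁ ⊋ ⋯ ⊋ Sₘ of h-negative r-upsets.
    signedChains : BRel n → ℕ → Subset n → Carrier
    signedChains r zero B = 1#
    signedChains r (suc k) B = 1# + - ∑[ S ∈ allSubsets n ] (ind (negativeUpset r S ∧ S ⊂ᵇ B) * signedChains r k S)

    chainSum-braidCone : ∀ r k B → chainSum k B (λ μ → braidCone r (toℚ μ)) ≈ signedChains r k B
    chainSum-braidCone r zero B = ≈-trans (braidCone≈ind r (toℚ 0ᵛ)) (ind-true (inBraidCone-0ᵛ r))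
    chainSum-braidCone r (suc k) B =
      +-cong (≈-trans (braidCone≈ind r (toℚ 0ᵛ)) (ind-true (inBraidCone-0ᵛ r))) (-‿cong (∑-cong (allSubsets n) term))
      where
      raised : ∀ S μ → SupportedIn μ S → braidCone r (toℚ (raise S μ)) ≈ ind (upClosed r S) * braidCone r (toℚ μ)
      raised S μ μ∈S = begin
        braidCone r (toℚ (raise S μ))                         ≈⟨ braidCone≈ind r (toℚ (raise S μ)) ⟩
        ind (inBraidCone r (toℚ (raise S μ)))                 ≈⟨ ≈-reflexive (cong ind (inBraidCone-raise r μ∈S)) ⟩
        ind (upClosed r S ∧ inBraidCone r (toℚ μ))            ≈⟨ ind-∧ _ _ ⟩
        ind (upClosed r S) * ind (inBraidCone r (toℚ μ))      ≈⟨ *-congˡ (≈-sym (braidCone≈ind r (toℚ μ))) ⟩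
        ind (upClosed r S) * braidCone r (toℚ μ)              ∎
      term : ∀ S → ind (negative h S ∧ S ⊂ᵇ B) * chainSum k S (λ μ → braidCone r (toℚ (raise S μ)))
                 ≈ ind (negativeUpset r S ∧ S ⊂ᵇ B) * signedChains r k S
      term S = begin
        ind b * chainSum k S (λ μ → braidCone r (toℚ (raise S μ)))
          ≈⟨ *-congˡ (chainSum-cong k S (raised S)) ⟩
        ind b * chainSum k S (λ μ → ind (upClosed r S) * braidCone r (toℚ μ))
          ≈⟨ *-congˡ (chainSum-*ˡ k S (ind (upClosed r S)) (λ μ → braidCone r (toℚ μ))) ⟩
        ind b * (ind (upClosed r S) * chainSum k S (λ μ → braidCone r (toℚ μ)))
          ≈⟨ *-congˡ (*-congˡ (chainSum-braidCone r k S)) ⟩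
        ind b * (ind (upClosed r S) * signedChains r k S)
          ≈⟨ ≈-sym (*-assoc _ _ _) ⟩
        ind b * ind (upClosed r S) * signedChains r k S
          ≈⟨ *-congʳ (≈-sym (ind-∧ b _)) ⟩
        ind (b ∧ upClosed r S) * signedChains r k S
          ≈⟨ ≈-reflexive (cong (λ b → ind b * signedChains r k S) (∧-swapʳ (negative h S) (S ⊂ᵇ B) (upClosed r S))) ⟩
        ind (negativeUpset r S ∧ S ⊂ᵇ B) * signedChains r k S
          ∎
        where
        b : Bool
        b = negative h S ∧ S ⊂ᵇ B

  -- If M is h-negative, S ↦ S ∩ M contracts the poset of h-negative r-upsets and the signed chain count
  -- is 0; otherwise there are no h-negative r-upsets and h lies in the cone.
  module ConeValue {n : ℕ} (h : Fin n → ℚ) (h0 : totalSum h ≡ 0ℚ) (r : BRel n) where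
    open Chains h
    open Minimiser h r

    private
      U : Subset n → Bool
      U = negativeUpset r

      W : ℕ → Subset n → Carrier
      W = signedChains r

    signedChains-cong : ∀ k {B B′} → B ≐ B′ → W k B ≈ W k B′
    signedChains-cong zero e = ≈-refl
    signedChains-cong (suc k) e = +-congˡ (-‿cong (∑-cong (allSubsets n) λ S →
      ≈-reflexive (cong (λ b → ind (U S ∧ b) * W k S) (⊂ᵇ-congʳ S e))))

    signedChains-stable : ∀ k B → size B ≤ k → W (suc k) B ≈ W k B
    signedChains-stable zero B B≤0 =
      ≈-trans (+-congˡ (-‿cong (∑-zero (allSubsets n) λ S → ind-*-vanish (U S ∧ S ⊂ᵇ B) λ c →
                 ⊥-elim (ℕP.n≮0 (ℕP.<-≤-trans (⊂ᵇ-size (∧-elimʳ {U S} c)) B≤0)))))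
              (x-0#≈x 1#)
    signedChains-stable (suc k) B B≤ = +-congˡ (-‿cong (∑-cong (allSubsets n) λ S →
      ind-*-cong (U S ∧ S ⊂ᵇ B) λ c → signedChains-stable k S (⊂ᵇ-size-≤ (∧-elimʳ {U S} c) B≤)))

    signedChains-∑⊆ : ∀ k T → U T ≡ true → size T ≤ k → ∑[ S ∈ allSubsets n ] (ind (U S ∧ S ⊆ᵇ T) * W k S) ≈ 1#
    signedChains-∑⊆ zero T UT T≤0 with negative-nonempty h (∧-elimˡ UT)
    ... | i , Ti = ⊥-elim (ℕP.n≮0 (ℕP.<-≤-trans (size-pos i Ti) T≤0))
    signedChains-∑⊆ (suc k) T UT T≤ = begin
      ∑[ S ∈ allSubsets n ] (ind (U S ∧ S ⊆ᵇ T) * W (suc k) S)  ≈⟨ ∑-cong (allSubsets n) split ⟩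
      ∑[ S ∈ allSubsets n ] (A S + B S)                       ≈⟨ ∑-+ (allSubsets n) A B ⟩
      ∑ (allSubsets n) A + ∑ (allSubsets n) B                 ≈⟨ +-congʳ (∑-allSubsets-single A T atT offT) ⟩
      (1# + - ∑ (allSubsets n) B) + ∑ (allSubsets n) B        ≈⟨ +-assoc _ _ _ ⟩
      1# + (- ∑ (allSubsets n) B + ∑ (allSubsets n) B)        ≈⟨ +-congˡ (-‿inverseˡ _) ⟩
      1# + 0#                                                 ≈⟨ +-identityʳ 1# ⟩
      1#                                                      ∎
      where
      A B : Subset n → Carrier
      A S = ind (U S ∧ (S ⊆ᵇ T ∧ T ⊆ᵇ S)) * W (suc k) S
      B S = ind (U S ∧ S ⊂ᵇ T) * W k S
      split : ∀ S → ind (U S ∧ S ⊆ᵇ T) * W (suc k) S ≈ A S + B S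
      split S = ≈-trans (*-congʳ (ind-split-∧ʳ (U S) (S ⊆ᵇ T) (T ⊆ᵇ S))) (≈-trans (distribʳ _ _ _)
                  (+-congˡ (ind-*-cong (U S ∧ S ⊂ᵇ T) λ c → signedChains-stable k S (⊂ᵇ-size-≤ (∧-elimʳ {U S} c) T≤))))
      atT : ∀ S → S ≐ T → A S ≈ W (suc k) T
      atT S S≐T = ≈-trans (*-cong (ind-true (∧-intro (trans (negativeUpset-cong S≐T) UT)
                                                     (∧-intro (≐⇒⊆ᵇ S≐T) (≐⇒⊆ᵇ (sym ∘ S≐T)))))
                                  (signedChains-cong (suc k) S≐T))
                          (*-identityˡ _)
      offT : ∀ S → ¬ S ≐ T → A S ≈ 0#
      offT S S≭T = ind-*-vanish (U S ∧ (S ⊆ᵇ T ∧ T ⊆ᵇ S)) λ c →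
        ⊥-elim (S≭T (⊆ᵇ-antisym (∧-elimˡ (∧-elimʳ {U S} c)) (∧-elimʳ {S ⊆ᵇ T} (∧-elimʳ {U S} c))))

    signedChains-vanish : ∀ k B → upClosed r B ≡ true → size B ≤ k → negative h (B ∩ M) ≡ true →
      ∀ i → B i ≡ true → M i ≡ false → W k B ≈ 0#
    signedChains-vanish zero B _ B≤0 _ i Bi _ = ⊥-elim (ℕP.n≮0 (ℕP.<-≤-trans (size-pos i Bi) B≤0))
    signedChains-vanish (suc k) B upB B≤ negT i Bi Mi = begin
      1# + - ∑[ S ∈ allSubsets n ] (ind (U S ∧ S ⊂ᵇ B) * W k S)
        ≈⟨ +-congˡ (-‿cong (∑-cong (allSubsets n) termwise)) ⟩
      1# + - ∑[ S ∈ allSubsets n ] (ind (U S ∧ S ⊆ᵇ T) * W k S)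
        ≈⟨ +-congˡ (-‿cong (signedChains-∑⊆ k T UT (⊂ᵇ-size-≤ T⊂B B≤))) ⟩
      1# + - 1#
        ≈⟨ -‿inverseʳ 1# ⟩
      0# ∎
      where
      T : Subset n
      T = B ∩ M
      UT : U T ≡ true
      UT = ∧-intro negT (upClosed-∩ r upB M-upClosed)
      T⊂B : T ⊂ᵇ B ≡ true
      T⊂B = ⊂ᵇ-intro (⊆ᵇ-intro λ _ → ∧-elimˡ) i Bi (trans (cong (B i ∧_) Mi) (∧-zeroʳ (B i)))
      termwise : ∀ S → ind (U S ∧ S ⊂ᵇ B) * W k S ≈ ind (U S ∧ S ⊆ᵇ T) * W k S
      termwise S with U S in US
      ... | false = ≈-refl
      ... | true with S ⊆ᵇ M in S⊆M
      ...   | true = ≈-reflexive (cong (λ b → ind b * W k S) (⊂ᵇ≡⊆ᵇ∩ S⊆M i Bi Mi))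
      ...   | false with ⊆ᵇ-false-witness S⊆M
      ...     | j , Sj , Mj = ≈-trans
        (ind-*-vanish (S ⊂ᵇ B) λ S⊂B → signedChains-vanish k S upS (⊂ᵇ-size-≤ S⊂B B≤) (∩M-negative upS negS) j Sj Mj)
        (≈-sym (ind-false-* _ (¬-not λ S⊆T → false≢true (trans (sym S⊆M) (⊆ᵇ∩⇒⊆ᵇʳ S⊆T)))))
        where
        upS : upClosed r S ≡ true
        upS = ∧-elimʳ {negative h S} US
        negS : negative h S ≡ true
        negS = ∧-elimˡ US

    signedChains≈checkCone : W n full ≈ checkCone r h
    signedChains≈checkCone with negative h M in negM
    ... | true = ≈-trans (signedChains-vanish n full (upClosed-full r) (size-bound full) negM i refl Mi) (≈-sym (ind-false h∉))
      where
      i : Fin n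
      i = proj₁ (negative-proper h h0 negM)
      Mi : M i ≡ false
      Mi = proj₂ (negative-proper h h0 negM)
      h∉ : inDualCone r h ≡ false
      h∉ = inDualCone-false {r = r} {h} {M} M-upClosed (negative-twoLump h h0 negM) (negative-sound h negM)
    ... | false = ≈-trans (W≈1 n) (≈-sym (ind-true (inDualCone-intro {r = r} h0 λ upS _ → upset-nonnegative upS)))
      where
      upset-nonnegative : ∀ {S} → upClosed r S ≡ true → 0ℚ ℚ.≤ pairingST S h
      upset-nonnegative upS = ℚP.≤-trans (negative-false h negM) (M-minimal upS)
      W≈1 : ∀ k → W k full ≈ 1#
      W≈1 zero = ≈-refl
      W≈1 (suc k) = ≈-trans (+-congˡ (-‿cong (∑-zero (allSubsets n) λ S → ind-*-vanish (U S ∧ S ⊂ᵇ full) λ c →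
                      ⊥-elim (<⇒≱ (negative-sound h (∧-elimˡ (∧-elimˡ c)))
                                  (upset-nonnegative (∧-elimʳ {negative h S} (∧-elimˡ c)))))))
                    (x-0#≈x 1#)

  module FaceValue {n : ℕ} (h : Fin n → ℚ) (h0 : totalSum h ≡ 0ℚ) (F : Composition n) where
    open Chains h
    open Lumps F

    FaceAt : ℕ → Subset n → ((Fin n → ℕ) → Carrier) → Set ℓ
    FaceAt k B g = ∀ μ → SupportedIn μ B → (Induced (ν k +ᵛ μ) → g μ ≈ 1#) × (¬ Induced (ν k +ᵛ μ) → g μ ≈ 0#)

    face-step : ∀ {k S B g} → S ≐ firstLumps k → k < l F → S ⊆ᵇ B ≡ true → FaceAt (suc k) B g →
      FaceAt k S (g ∘ raise S)
    face-step {k} {S} S≐ k<l S⊆B face μ μ∈S =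
      (λ ind → proj₁ (face (raise S μ) μ′∈B) (induced-cong shift ind)) ,
      (λ ¬ind → proj₂ (face (raise S μ) μ′∈B) (¬ind ∘ induced-cong (sym ∘ shift)))
      where
      μ′∈B : SupportedIn (raise S μ) _
      μ′∈B = raise-supportedIn S⊆B μ∈S
      shift : ∀ i → ν k i ℕ.+ μ i ≡ ν (suc k) i ℕ.+ raise S μ i
      shift i rewrite S≐ i | ν-step i k<l = ℕP.+-assoc (ν (suc k) i) _ (μ i)

    chain-step : ∀ {k S B} → S ≐ firstLumps k → B ≐ firstLumps (suc k) → k < l F → S ⊂ᵇ B ≡ true
    chain-step {k} {S} {B} S≐ B≐ k<l with lump-surj k<l
    ... | j , Lj = ⊂ᵇ-intro
      (⊆ᵇ-intro λ i Si → trans (B≐ i) (firstLumps-intro (ℕP.m≤n⇒m≤1+n (firstLumps-elim (trans (sym (S≐ i)) Si)))))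
                            j (trans (B≐ j) (firstLumps-intro (s≤s (ℕP.≤-reflexive Lj))))
                            (trans (S≐ j) (firstLumps-false (ℕP.≤-reflexive (sym Lj))))

    off-chain-vanish : ∀ k f {B g} → B ≐ firstLumps (suc k) → suc k ≤ l F → FaceAt (suc k) B g →
      ∀ S → ¬ S ≐ firstLumps k → ind (negative h S ∧ S ⊂ᵇ B) * chainSum f S (g ∘ raise S) ≈ 0#
    off-chain-vanish k f {B} B≐ k<l face S S≭ = ind-*-vanish (negative h S ∧ S ⊂ᵇ B) λ c →
      chainSum-vanish f S λ μ μ∈S → proj₂ (face (raise S μ) (raise-supportedIn (∧-elimˡ (∧-elimʳ {negative h S} c)) μ∈S))
        (off-chain-not-induced k B≐ k<l (∧-elimʳ {negative h S} c) S≭ μ∈S)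

    chainSum-face₀ : ∀ f B g → B ≐ firstLumps 1 → 1 ≤ l F → FaceAt 1 B g → chainSum f B g ≈ 1#
    chainSum-face₀ zero B g B≐ 1≤l face = proj₁ (face 0ᵛ (λ _ _ → refl)) ν1-induced
    chainSum-face₀ (suc f) B g B≐ 1≤l face = begin
      g 0ᵛ + - ∑ (allSubsets n) term
        ≈⟨ +-cong (proj₁ (face 0ᵛ (λ _ _ → refl)) ν1-induced) (-‿cong (∑-allSubsets-single term ∅ on-chain off-chain)) ⟩
      1# + - 0#
        ≈⟨ x-0#≈x 1# ⟩
      1# ∎
      where
      term : Subset n → Carrier
      term S = ind (negative h S ∧ S ⊂ᵇ B) * chainSum f S (g ∘ raise S)
      on-chain : ∀ S → S ≐ ∅ → term S ≈ 0#
      on-chain S S≐∅ = ind-*-vanish (negative h S ∧ S ⊂ᵇ B) λ c →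
        ⊥-elim (ℚP.<-irrefl (trans (pairing-cong h S≐∅) (pairing-∅ h)) (negative-sound h (∧-elimˡ c)))
      off-chain : ∀ S → ¬ S ≐ ∅ → term S ≈ 0#
      off-chain S S≭∅ = off-chain-vanish zero f B≐ 1≤l face S (λ S≐ → S≭∅ λ i → trans (S≐ i) (firstLumps-false z≤n))

    chainSum-face : ∀ k f B g → B ≐ firstLumps (suc k) → suc k ≤ l F → size B ≤ f → FaceAt (suc k) B g →
      chainSum f B g ≈ sign k * ind (negativeFlags h h0 k)
    chainSum-face zero f B g B≐ 1≤l _ face = ≈-trans (chainSum-face₀ f B g B≐ 1≤l face) (≈-sym (*-identityˡ 1#))
    chainSum-face (suc k) zero B g B≐ k<l B≤0 face with lump-surj (ℕP.<-≤-trans (s≤s z≤n) k<l)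
    ... | i₀ , L0 = ⊥-elim (ℕP.n≮0 (ℕP.<-≤-trans (size-pos i₀ Bi₀) B≤0))
      where
      Bi₀ : B i₀ ≡ true
      Bi₀ = trans (B≐ i₀) (firstLumps-intro (subst (_< 2 ℕ.+ k) (sym L0) (s≤s z≤n)))
    chainSum-face (suc k) (suc f) B g B≐ k<l B≤f face = begin
      g 0ᵛ + - ∑ (allSubsets n) term
        ≈⟨ +-cong (proj₂ (face 0ᵛ (λ _ _ → refl)) (ν2+-not-induced k k<l))
                  (-‿cong (∑-allSubsets-single term (firstLumps (suc k)) on-chain off-chain)) ⟩
      0# + - (ind a * (sign k * ind b))
        ≈⟨ +-identityˡ _ ⟩
      - (ind a * (sign k * ind b))
        ≈⟨ -‿cong (solve 3 (λ a s b → (a ⊗ (s ⊗ b)) ⊜ (s ⊗ (a ⊗ b))) ≈-refl (ind a) (sign k) (ind b)) ⟩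
      - (sign k * (ind a * ind b))
        ≈⟨ -‿distribˡ-* _ _ ⟩
      - sign k * (ind a * ind b)
        ≈⟨ *-congˡ (≈-sym (ind-∧ a b)) ⟩
      sign (suc k) * ind (a ∧ b) ∎
      where
      a b : Bool
      a = negative h (firstLumps (suc k))
      b = negativeFlags h h0 k
      term : Subset n → Carrier
      term S = ind (negative h S ∧ S ⊂ᵇ B) * chainSum f S (g ∘ raise S)
      on-chain : ∀ S → S ≐ firstLumps (suc k) → term S ≈ ind a * (sign k * ind b)
      on-chain S S≐ = *-cong
        (≈-reflexive (cong ind (trans (cong (negative h S ∧_) S⊂B) (trans (∧-identityʳ _) (negative-cong h S≐)))))
        (chainSum-face k f S (g ∘ raise S) S≐ (ℕP.<⇒≤ k<l) (⊂ᵇ-size-≤ S⊂B B≤f) (face-step S≐ k<l (∧-elimˡ S⊂B) face))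
        where
        S⊂B : S ⊂ᵇ B ≡ true
        S⊂B = chain-step S≐ B≐ k<l
      off-chain : ∀ S → ¬ S ≐ firstLumps (suc k) → term S ≈ 0#
      off-chain = off-chain-vanish (suc k) f B≐ k<l face

  module _ {n : ℕ} (F : Composition n) where

    -- M̂_F = ∏_{(a,b)} (Ĉ_ab if a ≥_F b, else 1 − Ĉ_ab); each factor is added to the relation
    -- or splits the term, so the product expands into signed braid cones of relations.
    expand : List (Fin n × Fin n) → BRel n → Carrier → List (Carrier × BRel n)
    expand [] r c = (c , r) ∷ []
    expand ((a , b) ∷ ps) r c =
      if compRel F a b then expand ps (addPair r a b) c else expand ps r c ++ expand ps (addPair r a b) (- c)

    addPair-∧ : ∀ (r : BRel n) a b x P → inBraidCone (addPair r a b) x ∧ P ≡ inBraidCone r x ∧ ((x b ℚ.≤ᵇ x a) ∧ P)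
    addPair-∧ r a b x P = trans (cong (_∧ P) (inBraidCone-addPair r a b x)) (∧-assoc (inBraidCone r x) (x b ℚ.≤ᵇ x a) P)

    coneSum : List (Carrier × BRel n) → (Fin n → ℚ) → Carrier
    coneSum ts x = ∑[ t ∈ ts ] (proj₁ t * ind (inBraidCone (proj₂ t) x))

    expand-eval : ∀ ps r c x → coneSum (expand ps r c) x ≈ c * ind (inBraidCone r x ∧ all (agrees F x) ps)
    expand-eval [] r c x = ≈-trans (+-identityʳ _) (*-congˡ (≈-reflexive (cong ind (sym (∧-identityʳ _)))))
    expand-eval ((a , b) ∷ ps) r c x with compRel F a b
    ... | true = begin
      coneSum (expand ps (addPair r a b) c) x           ≈⟨ expand-eval ps (addPair r a b) c x ⟩
      c * ind (inBraidCone (addPair r a b) x ∧ P)       ≈⟨ *-congˡ (≈-reflexive (cong ind (addPair-∧ r a b x P))) ⟩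
      c * ind (inBraidCone r x ∧ ((x b ℚ.≤ᵇ x a) ∧ P))    ∎
      where
      P : Bool
      P = all (agrees F x) ps
    ... | false = begin
      coneSum (expand ps r c ++ expand ps (addPair r a b) (- c)) x
        ≈⟨ ∑-++ (expand ps r c) _ _ ⟩
      coneSum (expand ps r c) x + coneSum (expand ps (addPair r a b) (- c)) x
        ≈⟨ +-cong (expand-eval ps r c x) (expand-eval ps (addPair r a b) (- c) x) ⟩
      c * ind (A ∧ P) + - c * ind (inBraidCone (addPair r a b) x ∧ P)
        ≈⟨ +-cong (*-congˡ (ind-split-∧ˡ A le P))
                  (≈-trans (≈-sym (-‿distribˡ-* _ _)) (-‿cong (*-congˡ (≈-reflexive (cong ind (addPair-∧ r a b x P)))))) ⟩
      c * (ind (A ∧ (le ∧ P)) + ind (A ∧ (not le ∧ P))) + - (c * ind (A ∧ (le ∧ P)))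
        ≈⟨ +-congʳ (distribˡ c _ _) ⟩
      (c * ind (A ∧ (le ∧ P)) + c * ind (A ∧ (not le ∧ P))) + - (c * ind (A ∧ (le ∧ P)))
        ≈⟨ solve 3 (λ u v w → ((u ⊕ v) ⊕ w) ⊜ (v ⊕ (u ⊕ w))) ≈-refl _ _ _ ⟩
      c * ind (A ∧ (not le ∧ P)) + (c * ind (A ∧ (le ∧ P)) + - (c * ind (A ∧ (le ∧ P))))
        ≈⟨ ≈-trans (+-congˡ (-‿inverseʳ _)) (+-identityʳ _) ⟩
      c * ind (A ∧ (not le ∧ P)) ∎
      where
      A le P : Bool
      A = inBraidCone r x
      le = x b ℚ.≤ᵇ x a
      P = all (agrees F x) ps

    faceCombo : Combo n
    faceCombo = map (λ t → proj₁ t , closure (proj₂ t)) (expand (pairs n) (λ _ _ → false) 1#)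

    evalHat-faceCombo : ∀ x → evalHat faceCombo x ≈ ind (all (agrees F x) (pairs n))
    evalHat-faceCombo x = begin
      evalHat faceCombo x                                           ≈⟨ closures (expand (pairs n) (λ _ _ → false) 1#) ⟩
      coneSum (expand (pairs n) (λ _ _ → false) 1#) x               ≈⟨ expand-eval (pairs n) (λ _ _ → false) 1# x ⟩
      1# * ind (inBraidCone (λ _ _ → false) x ∧ all (agrees F x) (pairs n)) ≈⟨ *-identityˡ _ ⟩
      ind (inBraidCone (λ _ _ → false) x ∧ all (agrees F x) (pairs n))
        ≈⟨ ≈-reflexive (cong (λ v → ind (v ∧ all (agrees F x) (pairs n))) empty-cone) ⟩
      ind (all (agrees F x) (pairs n))                              ∎
      where
      empty-cone : inBraidCone (λ _ _ → false) x ≡ true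
      empty-cone = inBraidCone-intro {r = λ _ _ → false} {x = x} λ ()
      closures : ∀ ts → evalHat (map (λ t → proj₁ t , closure (proj₂ t)) ts) x ≈ coneSum ts x
      closures [] = ≈-refl
      closures ((c , r) ∷ ts) =
        +-cong (*-congˡ (≈-trans (braidCone≈ind (closureRel r) x) (≈-reflexive (cong ind (inBraidCone-closure r x)))))
                                       (closures ts)

    faceCombo-represents : RepresentsHatM F faceCombo
    faceCombo-represents x =
      (λ ind → ≈-trans (evalHat-faceCombo x) (ind-true (Equivalence.from (all-agrees⇔induced F x) ind))) ,
      (λ ¬ind → ≈-trans (evalHat-faceCombo x) (ind-false (¬-not (¬ind ∘ Equivalence.to (all-agrees⇔induced F x)))))

  -- The chain functional of h realises 𝒟 at h: it sends Σ cₚ Ĉₚ to Σ cₚ Čₚ(h).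
  evalCheck≈chainSum : ∀ {n} h → totalSum h ≡ 0ℚ → (cs : Combo n) →
    evalCheck cs h ≈ Chains.chainSum h n full (λ μ → evalHat cs (toℚ μ))
  evalCheck≈chainSum {n} h h0 cs = begin
    evalCheck cs h
      ≈⟨ evalCheck-∑ cs ⟩
    ∑[ t ∈ cs ] (proj₁ t * checkCone (rel (proj₂ t)) h)
      ≈⟨ ∑-cong cs (λ t → *-congˡ (≈-sym (cone t))) ⟩
    ∑[ t ∈ cs ] (proj₁ t * chainSum n full (λ μ → braidCone (rel (proj₂ t)) (toℚ μ)))
      ≈⟨ ≈-sym (chainSum-evalHat n full cs) ⟩
    chainSum n full (λ μ → evalHat cs (toℚ μ)) ∎
    where
    open Chains h
    evalCheck-∑ : ∀ cs → evalCheck cs h ≈ ∑[ t ∈ cs ] (proj₁ t * checkCone (rel (proj₂ t)) h)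
    evalCheck-∑ [] = ≈-refl
    evalCheck-∑ (t ∷ cs) = +-congˡ (evalCheck-∑ cs)
    cone : ∀ t → chainSum n full (λ μ → braidCone (rel (proj₂ t)) (toℚ μ)) ≈ checkCone (rel (proj₂ t)) h
    cone t = ≈-trans (chainSum-braidCone (rel (proj₂ t)) n full) (ConeValue.signedChains≈checkCone h h0 (rel (proj₂ t)))

  RepresentsHatM⇒RepresentsCheckM : ∀ {n} (F : Composition n) {k} → l F ≡ suc k →
    (cs : Combo n) → RepresentsHatM F cs → RepresentsCheckM F cs
  RepresentsHatM⇒RepresentsCheckM {n} F {k} l≡ cs rep h h0 =
    (λ relint → subst (λ m → evalCheck cs h ≈ sign (m ℕ.∸ 1)) (sym l≡)
                  (≈-trans value (≈-trans (*-congˡ (ind-true (relint⇒negativeFlags h h0 l≡ relint))) (*-identityʳ _)))) ,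
    (λ ¬relint → ≈-trans value (≈-trans (*-congˡ (ind-false (¬-not (¬relint ∘ negativeFlags⇒relint h h0 l≡)))) (zeroʳ _)))
    where
    open Lumps F
    open FaceValue h h0 F
    full≐ : full ≐ firstLumps (suc k)
    full≐ i = sym (firstLumps-intro (subst (L i <_) l≡ (L< i)))
    face : FaceAt (suc k) full (λ μ → evalHat cs (toℚ μ))
    face μ _ = (λ ind → proj₁ (rep (toℚ μ)) (induced-cong ν≡0 ind)) ,
               (λ ¬ind → proj₂ (rep (toℚ μ)) (¬ind ∘ induced-cong (sym ∘ ν≡0)))
      where
      ν≡0 : ∀ i → ν (suc k) i ℕ.+ μ i ≡ μ i
      ν≡0 i = cong (ℕ._+ μ i)
        (trans (ν-low i (subst (suc (L i) ≤_) l≡ (L< i))) (trans (cong (ℕ._∸ suc k) l≡) (ℕP.n∸n≡0 (suc k))))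
    value : evalCheck cs h ≈ sign k * ind (negativeFlags h h0 k)
    value = ≈-trans (evalCheck≈chainSum h h0 cs)
                    (chainSum-face k n full _ full≐ (ℕP.≤-reflexive (sym l≡)) (size-bound full) face)

nonempty⇒suc : ∀ {m} → Fin m → m ≡ suc (m ℕ.∸ 1)
nonempty⇒suc {suc m} _ = refl

mainTheorem8 : ∀ {c ℓ : Level} (R : CommutativeRing c ℓ) → IsFieldCR R → CharZero R →
    (n : ℕ) (F : Composition (suc n)) →
    (Σ[ cs ∈ Over.Combo R (suc n) ] Over.RepresentsHatM R F cs) ×
    (∀ (cs : Over.Combo R (suc n)) → Over.RepresentsHatM R F cs → Over.RepresentsCheckM R F cs)
mainTheorem8 R _ _ n F =
  (faceCombo R F , faceCombo-represents R F) ,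
  RepresentsHatM⇒RepresentsCheckM R F (nonempty⇒suc (lump F Fin.zero))
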